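{- Let $w$ be a permutation and $F$ a binary indexed forest with $\mathrm{code}(F)=\mathrm{code}(w)$. For every valid labeling $f$ of $F$, starting from the bottom pipe dream $P_{\mathrm{bott}}(w)$ it is possible, using only simple ladder moves, to move each crossing $c_v$ ($v\in\mathrm{IN}(F)$) along its northeast diagonal to row $f(v)$. The resulting pipe dream $\psi_w(f)$ is a reduced pipe dream for $w$, the map $f\mapsto\psi_w(f)$ from valid labelings of $F$ to reduced pipe dreams of $w$ is injective, and every pipe dream in its image is obtained from $P_{\mathrm{bott}}(w)$ by a sequence of simple ladder moves.
   Context: Binary indexed forests: let $S$ be a finite set of positive integers, decomposed into maximal intervals of consecutive integers $I_1,\dots,I_k$. A binary indexed forest $F$ supported on $S$ consists of a full binary tree $T_i$ for each $i$ whose leaves, left to right, are attached to the integers of $I_i$. Non-leaf vertices form the set $\mathrm{IN}(F)$ of interior vertices. For $v\in\mathrm{IN}(F)$, $\rho_F(v)$ is the label of the leaf reached from $v$ by following left-child edges. A labeling $f:\mathrm{IN}(F)\to\mathbb{Z}_{>0}$ is valid if $f(v)\le\rho_F(v)$ for all $v$, $f(v)\le f(u)$ whenever $u$ is the left child of $v$, and $f(v)<f(u)$ whenever $u$ is the right child of $v$. $\mathrm{code}(F)=(L_F(1),L_F(2),\dots)$ with $L_F(i)=\#\{v\in\mathrm{IN}(F):\rho_F(v)=i\}$. The Lehmer code of $w$ is $\mathrm{code}(w)=(L(1),L(2),\dots)$ with $L(i)=\#\{j>i: w(j)<w(i)\}$. Pipe dreams: a (reduced) pipe dream for $w$ is a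 finite set $D$ of cells $(r,c)\in\mathbb{Z}_{>0}^2$ (row $r$, column $c$, rows numbered top to bottom), each cell of $D$ being a crossing, such that the word in simple transpositions $s_{r+c-1}$, $(r,c)\in D$, read in the standard order, is a reduced word for $w$ (so that $\mathfrak{S}_w=\sum_D\prod_{(r,c)\in D}x_r$). The cell $(r,c)$ lies on northeast diagonal $r+c-1$. The bottom pipe dream $P_{\mathrm{bott}}(w)$ is the left-justified pipe dream with crossings $\{(i,c):1\le c\le L(i)\}$. A simple ladder move replaces a crossing $(r,c)\in D$ by $(r-1,c+1)$, allowed when $(r-1,c),(r-1,c+1),(r,c+1)\notin D$. Correspondence: number the crossings in row $i$ of $P_{\mathrm{bott}}(w)$ as $1,\dots,L(i)$ from left to right, and number the interior vertices $v$ with $\rho_F(v)=i$ (which form the chain of left ancestors above leaf $i$) as $1,\dots,L_F(i)$ from bottom to top. The crossing numbered $j$ in row $i$ is denoted $c_v$, where $v$ is the vertex numbered $j$ among those with $\rho_F(v)=i$. Note $c_v$ lies in row $\rho_F(v)\ge f(v)$. -}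

module Defs where

open import Data.Nat using (ℕ; zero; suc; _+_; _∸_; _≤_; _<_; _<?_)
open import Data.Nat.Properties using (_≟_)
open import Data.Fin using (Fin; toℕ; fromℕ<)
open import Data.Fin.Permutation using (Permutation′; _⟨$⟩ʳ_)
open import Data.List using (List; []; _∷_; map; length; filter; concatMap; upTo; allFin; lookup; reverse)
open import Data.Nat.ListAction using (sum)
open import Data.List.Relation.Unary.All using (All)
open import Data.Product using (Σ; ∃; _×_; _,_; proj₁; proj₂)
open import Data.Product.Properties using (≡-dec)
open import Data.Sum using (_⊎_)
open import Data.Unit using (⊤)
open import Data.Bool using (if_then_else_)
open import Relation.Nullary using (¬_; yes; no; does)
open import Relation.Binary.PropositionalEquality using (_≡_; _≢_)
import Data.List.Membership.DecPropositional as DecMem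

from1 : ℕ → List ℕ
from1 n = map suc (upTo n)

-- A permutation w ∈ S_n, viewed as a map on positive integers
-- (w(i) for 1 ≤ i ≤ n, and w(i) = i for i > n; the value at 0 is 0).
ext : ∀ {n} → Permutation′ n → ℕ → ℕ
ext w zero = zero
ext {n} w (suc i) with i <? n
... | yes p = suc (toℕ (w ⟨$⟩ʳ fromℕ< p))
... | no _  = suc i

-- Lehmer code: L(i) = #{ j > i : w(j) < w(i) }   (j ranges over i+1 .. n;
-- for j > n we have w(j) = j > w(i), so nothing is lost)
codeW : ∀ {n} → Permutation′ n → ℕ → ℕ
codeW {n} w i = length (filter (λ j → ext w j <? ext w i) (map (i +_) (from1 (n ∸ i))))

-- Coxeter length ℓ(w) = number of inversions = Σ_i L(i)
ℓ : ∀ {n} → Permutation′ n → ℕ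
ℓ {n} w = sum (map (codeW w) (from1 n))

s : ℕ → ℕ → ℕ
s k x with does (x ≟ k) | does (x ≟ suc k)
... | Data.Bool.true | _ = suc k
... | Data.Bool.false | Data.Bool.true = k
... | Data.Bool.false | Data.Bool.false = x

-- product s_{a1} s_{a2} ... s_{am}  (composition of maps, rightmost applied first)
prodWord : List ℕ → ℕ → ℕ
prodWord [] x = x
prodWord (a ∷ as) x = s a (prodWord as x)

-- Pipe dreams: finite sets of cells (row , column), as lists up to set equality

Cell : Set
Cell = ℕ × ℕ

PipeDream : Set
PipeDream = List Cell

open DecMem (≡-dec _≟_ _≟_) using (_∈_; _∉_; _∈?_)

_≋_ : PipeDream → PipeDream → Set
D ≋ E = ∀ x → (x ∈ D → x ∈ E) × (x ∈ E → x ∈ D)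

-- a bound B with every cell inside [0..B]²
bound : PipeDream → ℕ
bound D = sum (map (λ x → proj₁ x + proj₂ x) D)

-- word of a pipe dream, read in the standard order:
-- rows top to bottom, within each row right to left; cell (r,c) gives s_{r+c-1}
word : PipeDream → List ℕ
word D = concatMap (λ r → concatMap (λ c → if does ((r , c) ∈? D) then (r + c ∸ 1) ∷ [] else [])
                                      (reverse (from1 (bound D))))
                   (from1 (bound D))

Positive : Cell → Set
Positive (r , c) = 1 ≤ r × 1 ≤ c

IsReducedPD : ∀ {n} → Permutation′ n → PipeDream → Set
IsReducedPD w D = All Positive D
                × (∀ x → prodWord (word D) x ≡ ext w x)
                × length (word D) ≡ ℓ w

Pbott : ∀ {n} → Permutation′ n → PipeDream
Pbott {n} w = concatMap (λ i → map (λ c → (i , c)) (from1 (codeW w i))) (from1 n)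

LadderMove : PipeDream → PipeDream → Set
LadderMove D E = Σ ℕ λ r → Σ ℕ λ c →
    1 ≤ r × (suc r , c) ∈ D
  × (r , c) ∉ D × (r , suc c) ∉ D × (suc r , suc c) ∉ D
  × (∀ x → (x ∈ E → ((x ∈ D × x ≢ (suc r , c)) ⊎ x ≡ (r , suc c)))
         × (((x ∈ D × x ≢ (suc r , c)) ⊎ x ≡ (r , suc c)) → x ∈ E))

data Star (R : PipeDream → PipeDream → Set) : PipeDream → PipeDream → Set where
  ε   : ∀ {D} → Star R D D
  _◅_ : ∀ {D E G} → R D E → Star R E G → Star R D G

data Tree : Set where
  leaf : Tree
  node : Tree → Tree → Tree

leaves : Tree → ℕ
leaves leaf = 1
leaves (node l r) = leaves l + leaves r

-- interior vertices of a tree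
data Pos : Tree → Set where
  here : ∀ {l r} → Pos (node l r)
  goL  : ∀ {l r} → Pos l → Pos (node l r)
  goR  : ∀ {l r} → Pos r → Pos (node l r)

allPos : (T : Tree) → List (Pos T)
allPos leaf = []
allPos (node l r) = here ∷ (map goL (allPos l) Data.List.++ map goR (allPos r))

data LeftChild : {T : Tree} → Pos T → Pos T → Set where
  lc-here  : ∀ {a b r} → LeftChild {node (node a b) r} here (goL here)
  lc-left  : ∀ {l r} {p q : Pos l} → LeftChild p q → LeftChild {node l r} (goL p) (goL q)
  lc-right : ∀ {l r} {p q : Pos r} → LeftChild p q → LeftChild {node l r} (goR p) (goR q)

data RightChild : {T : Tree} → Pos T → Pos T → Set where
  rc-here  : ∀ {l a b} → RightChild {node l (node a b)} here (goR here)
  rc-left  : ∀ {l r} {p q : Pos l} → RightChild p q → RightChild {node l r} (goL p) (goL q)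
  rc-right : ∀ {l r} {p q : Pos r} → RightChild p q → RightChild {node l r} (goR p) (goR q)

-- label of the leftmost leaf below p, when the leaves of T are labelled o, o+1, ...
ρT : (T : Tree) → Pos T → ℕ → ℕ
ρT (node l r) here o = o
ρT (node l r) (goL p) o = ρT l p o
ρT (node l r) (goR p) o = ρT r p (o + leaves l)

subtree : (T : Tree) → Pos T → Tree
subtree (node l r) here = node l r
subtree (node l r) (goL p) = subtree l p
subtree (node l r) (goR p) = subtree r p

leftSpine : Tree → ℕ
leftSpine leaf = 0
leftSpine (node l r) = suc (leftSpine l)

-- A forest: list of (first leaf label a , tree T); T's leaves are attached to
-- a, a+1, ..., a + leaves T - 1.
Forest : Set
Forest = List (ℕ × Tree)

-- well-formedness: labels positive, intervals increasing and maximal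
-- (consecutive intervals separated by at least one missing integer)
WFfrom : ℕ → Forest → Set
WFfrom m [] = ⊤
WFfrom m ((a , T) ∷ F) = m ≤ a × WFfrom (a + leaves T + 1) F

WF : Forest → Set
WF F = WFfrom 1 F

treeOf : (F : Forest) → Fin (length F) → Tree
treeOf F k = proj₂ (lookup F k)

startOf : (F : Forest) → Fin (length F) → ℕ
startOf F k = proj₁ (lookup F k)

IN : Forest → Set
IN F = Σ (Fin (length F)) λ k → Pos (treeOf F k)

allIN : (F : Forest) → List (IN F)
allIN F = concatMap (λ k → map (k ,_) (allPos (treeOf F k))) (allFin (length F))

ρ : (F : Forest) → IN F → ℕ
ρ F (k , p) = ρT (treeOf F k) p (startOf F k)

codeF : Forest → ℕ → ℕ
codeF F i = length (filter (λ v → ρ F v ≟ i) (allIN F))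

-- the number (1-based, counted from the bottom) of v among the vertices u with
-- ρ_F(u) = ρ_F(v): these form the left spine above leaf ρ_F(v), and those at or
-- below v are exactly the left spine of the subtree rooted at v
num : (F : Forest) → IN F → ℕ
num F (k , p) = leftSpine (subtree (treeOf F k) p)

Valid : (F : Forest) → (IN F → ℕ) → Set
Valid F f = (∀ v → 1 ≤ f v)
          × (∀ v → f v ≤ ρ F v)
          × (∀ k (p q : Pos (treeOf F k)) → LeftChild p q → f (k , p) ≤ f (k , q))
          × (∀ k (p q : Pos (treeOf F k)) → RightChild p q → f (k , p) < f (k , q))

-- c_v sits at (ρ_F(v), num v) in P_bott; moved along its northeast diagonal
-- (r + c - 1 constant) to row f(v) it sits at (f(v), ρ_F(v) + num v - f(v)).
ψ : (F : Forest) → (IN F → ℕ) → PipeDream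
ψ F f = map (λ v → (f v , ρ F v + num F v ∸ f v)) (allIN F)

-- Write σ(v) = ρ(v) + num(v). The crossing c_v of ψ(f) is the cell (f(v), σ(v) − f(v)) on the
-- northeast diagonal σ(v) − 1, and ψ(ρ) = P_bott(w) because code(F) = code(w) numbers the vertices
-- over leaf i exactly as the crossings of row i. Starting from h = ρ, lower by one the label of a
-- topmost vertex v with f(v) < h(v): since the ancestors of v already carry f's labels and f, h are
-- valid, the cells north, northeast and east of c_v are empty, so this is a simple ladder move.
-- A ladder move only changes the reading word by commuting one letter past letters at distance ≥ 2,
-- so product and length are preserved and every ψ(f) is reduced because P_bott(w) is. Two distinct
-- vertices on one diagonal are joined through a right edge, so every valid labeling separates them
-- strictly; comparing ψ(f) = ψ(g) at a topmost vertex where f and g differ gives injectivity.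

module Submission where

open import Data.Bool using (Bool; true; false; if_then_else_; T)
open import Data.Empty using (⊥; ⊥-elim)
open import Data.Fin using (Fin; toℕ) renaming (zero to fzero; suc to fsuc)
import Data.Fin.Properties as Fin
open import Data.Fin.Permutation using (Permutation′; _⟨$⟩ʳ_; _⟨$⟩ˡ_; inverseˡ)
open import Data.List hiding (sum; find)
open import Data.List.Properties
open import Data.List.Relation.Unary.All as All using (All; []; _∷_)
open import Data.List.Relation.Unary.Any using (here; there; any?)
open import Data.List.Membership.Propositional using (_∈_; _∉_; find; lose)
open import Data.List.Membership.Propositional.Properties
  using (∈-map⁺; ∈-map⁻; ∈-concatMap⁺; ∈-concatMap⁻; ∈-++⁺ˡ; ∈-++⁺ʳ; ∈-allFin)
open import Data.Nat
open import Data.Nat.Induction using (<-wellFounded)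
open import Data.Nat.ListAction using (sum)
open import Data.Nat.Properties
open import Data.Product using (Σ; ∃; _×_; _,_; proj₁; proj₂)
import Data.Product.Properties
open import Data.Sum using (_⊎_; inj₁; inj₂; [_,_]′)
open import Function using (_∘_; id)
open import Induction.WellFounded using (Acc; acc)
open import Level using (0ℓ)
open import Relation.Binary.Bundles using (Setoid)
open import Relation.Binary.Definitions using (tri<; tri≈; tri>)
open import Relation.Binary.PropositionalEquality hiding ([_])
open import Relation.Nullary using (¬_; Dec; yes; no; does)
open import Relation.Nullary.Decidable using (dec-true; dec-false; ¬?; _×-dec_; decidable-stable)
open import Relation.Unary using (Decidable)

open import Defs
open import Data.List.Membership.DecPropositional (Data.Product.Properties.≡-dec _≟_ _≟_) using (_∈?_)
import Algebra.Properties.CommutativeMonoid.Sum +-0-commutativeMonoid as FinSum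

private
  variable
    A C : Set

concatMap-cong-∈ : ∀ {f g : A → List C} xs → (∀ {x} → x ∈ xs → f x ≡ g x) → concatMap f xs ≡ concatMap g xs
concatMap-cong-∈ xs eq = cong concat (map-cong-local (All.tabulate eq))

concatMap-≡[] : ∀ {f : A → List C} xs → (∀ {x} → x ∈ xs → f x ≡ []) → concatMap f xs ≡ []
concatMap-≡[] []       _     = refl
concatMap-≡[] (x ∷ xs) f≡[] = cong₂ _++_ (f≡[] (here refl)) (concatMap-≡[] xs (f≡[] ∘ there))

module _ {X : Set} (μ : X → ℕ) {xs : List X} (complete : ∀ x → x ∈ xs) {P : X → Set} (P? : Decidable P) where

  minimal : ∀ {x} → P x → ∃ λ y → P y × (∀ z → μ z < μ y → ¬ P z)
  minimal {x} Px = go x Px (<-wellFounded (μ x))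
    where
    go : ∀ x → P x → Acc _<_ (μ x) → ∃ λ y → P y × (∀ z → μ z < μ y → ¬ P z)
    go x Px (acc rec) with any? (λ z → (μ z <? μ x) ×-dec P? z) xs
    ... | yes ∃z = let (z , _ , μz<μx , Pz) = find ∃z in go z Pz (rec μz<μx)
    ... | no ∄z  = x , Px , λ z μz<μx Pz → ∄z (lose (complete z) (μz<μx , Pz))

module _ {g g′ : A → ℕ} (g≤g′ : ∀ x → g x ≤ g′ x) where

  sum-map-mono : ∀ xs → sum (map g xs) ≤ sum (map g′ xs)
  sum-map-mono []       = z≤n
  sum-map-mono (x ∷ xs) = +-mono-≤ (g≤g′ x) (sum-map-mono xs)

  sum-map-mono-< : ∀ {x₀ xs} → x₀ ∈ xs → g x₀ < g′ x₀ → sum (map g xs) < sum (map g′ xs)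
  sum-map-mono-< {xs = x ∷ xs} (here refl) gx<g′x = +-mono-<-≤ gx<g′x (sum-map-mono xs)
  sum-map-mono-< {xs = x ∷ xs} (there x₀∈) gx₀<g′x₀ = +-mono-≤-< (g≤g′ x) (sum-map-mono-< x₀∈ gx₀<g′x₀)

interval : ℕ → ℕ → List ℕ
interval a zero    = []
interval a (suc n) = a ∷ interval (suc a) n

countdown : ℕ → List ℕ
countdown zero    = []
countdown (suc n) = suc n ∷ countdown n

applyUpTo≡interval : ∀ (f : ℕ → ℕ) a n → (∀ i → f i ≡ a + i) → applyUpTo f n ≡ interval a n
applyUpTo≡interval f a zero    f≗a+ = refl
applyUpTo≡interval f a (suc n) f≗a+ =
  cong₂ _∷_ (trans (f≗a+ 0) (+-identityʳ a))
            (applyUpTo≡interval (f ∘ suc) (suc a) n (λ i → trans (f≗a+ (suc i)) (+-suc a i)))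

from1≡interval : ∀ n → from1 n ≡ interval 1 n
from1≡interval n = trans (map-upTo suc n) (applyUpTo≡interval suc 1 n (λ _ → refl))

interval-++ : ∀ a m n → interval a (m + n) ≡ interval a m ++ interval (a + m) n
interval-++ a zero    n = cong (λ b → interval b n) (sym (+-identityʳ a))
interval-++ a (suc m) n = cong (a ∷_) (trans (interval-++ (suc a) m n) (cong (λ b → interval (suc a) m ++ interval b n) (sym (+-suc a m))))

∈-interval⁻ : ∀ {x} a n → x ∈ interval a n → a ≤ x × x < a + n
∈-interval⁻ a (suc n) (here refl) = ≤-refl , m<m+n a z<s
∈-interval⁻ {x} a (suc n) (there x∈) with ∈-interval⁻ (suc a) n x∈
... | a<x , x<sa+n = <⇒≤ a<x , subst (x <_) (sym (+-suc a n)) x<sa+n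

∈-interval⁺ : ∀ {x} a n → a ≤ x → x < a + n → x ∈ interval a n
∈-interval⁺ a zero    a≤x x<a+0 = ⊥-elim (<⇒≱ x<a+0 (subst (_≤ _) (sym (+-identityʳ a)) a≤x))
∈-interval⁺ {x} a (suc n) a≤x x<a+n with a ≟ x
... | yes refl = here refl
... | no a≢x   = there (∈-interval⁺ (suc a) n (≤∧≢⇒< a≤x a≢x) (subst (x <_) (+-suc a n) x<a+n))

reverse-interval : ∀ n → reverse (interval 1 n) ≡ countdown n
reverse-interval zero    = refl
reverse-interval (suc n) = begin
  reverse (interval 1 (suc n))              ≡⟨ cong (reverse ∘ interval 1) (+-comm 1 n) ⟩
  reverse (interval 1 (n + 1))              ≡⟨ cong reverse (interval-++ 1 n 1) ⟩
  reverse (interval 1 n ++ [ suc n ])     ≡⟨ reverse-++ (interval 1 n) [ suc n ] ⟩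
  suc n ∷ reverse (interval 1 n)            ≡⟨ cong (suc n ∷_) (reverse-interval n) ⟩
  countdown (suc n)                         ∎
  where open ≡-Reasoning

∈-countdown⁻ : ∀ {x} n → x ∈ countdown n → 1 ≤ x × x ≤ n
∈-countdown⁻ (suc n) (here refl) = s≤s z≤n , ≤-refl
∈-countdown⁻ (suc n) (there x∈) with ∈-countdown⁻ n x∈
... | 1≤x , x≤n = 1≤x , m≤n⇒m≤1+n x≤n

countdown-split : ∀ {c B} → c ≤ B → ∃ λ hi → countdown B ≡ hi ++ countdown c × All (c <_) hi
countdown-split c≤B = go (≤⇒≤′ c≤B)
  where
  go : ∀ {c B} → c ≤′ B → ∃ λ hi → countdown B ≡ hi ++ countdown c × All (c <_) hi
  go ≤′-refl = [] , refl , []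
  go (≤′-step {n} c≤′n) with go c≤′n
  ... | hi , eq , c<hi = suc n ∷ hi , cong (suc n ∷_) eq , s≤s (≤′⇒≤ c≤′n) ∷ c<hi

∈-from1⁻ : ∀ {x} n → x ∈ from1 n → 1 ≤ x × x ≤ n
∈-from1⁻ n x∈ with ∈-interval⁻ 1 n (subst (_ ∈_) (from1≡interval n) x∈)
... | 1≤x , x<1+n = 1≤x , s≤s⁻¹ x<1+n

∈-from1⁺ : ∀ {x} n → 1 ≤ x → x ≤ n → x ∈ from1 n
∈-from1⁺ n 1≤x x≤n = subst (_ ∈_) (sym (from1≡interval n)) (∈-interval⁺ 1 n 1≤x (s≤s x≤n))

length-countdown : ∀ n → length (countdown n) ≡ n
length-countdown zero    = refl
length-countdown (suc n) = cong suc (length-countdown n)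

Grid : Set
Grid = ℕ → ℕ → Bool

letter : Grid → ℕ → ℕ → List ℕ
letter g r c = if g r c then (r + c ∸ 1) ∷ [] else []

rowWord : Grid → ℕ → ℕ → List ℕ
rowWord g B r = concatMap (letter g r) (countdown B)

gridWord : Grid → ℕ → List ℕ
gridWord g B = concatMap (rowWord g B) (interval 1 B)

occupied : PipeDream → Grid
occupied D r c = does ((r , c) ∈? D)

letter-cong : ∀ g g′ r c → g r c ≡ g′ r c → letter g r c ≡ letter g′ r c
letter-cong g g′ r c eq = cong (λ b → if b then (r + c ∸ 1) ∷ [] else []) eq

letter-false : ∀ g r c → g r c ≡ false → letter g r c ≡ []
letter-false g = letter-cong g (λ _ _ → false)

letters-All : ∀ (P : ℕ → Set) g r cs → (∀ {c} → c ∈ cs → P (r + c ∸ 1)) → All P (concatMap (letter g r) cs)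
letters-All P g r []       _ = []
letters-All P g r (c ∷ cs) p with g r c
... | true  = p (here refl) ∷ letters-All P g r cs (p ∘ there)
... | false = letters-All P g r cs (p ∘ there)

letters-full : ∀ g r cs → (∀ {c} → c ∈ cs → g r c ≡ true) → concatMap (letter g r) cs ≡ map (λ c → r + c ∸ 1) cs
letters-full g r []       _    = refl
letters-full g r (c ∷ cs) full = cong₂ _++_ (letter-cong g (λ _ _ → true) r c (full (here refl))) (letters-full g r cs (full ∘ there))

gridWord-cong : ∀ {g g′} B → (∀ r c → 1 ≤ r → r ≤ B → 1 ≤ c → c ≤ B → g r c ≡ g′ r c) → gridWord g B ≡ gridWord g′ B
gridWord-cong {g} {g′} B g≗g′ = concatMap-cong-∈ (interval 1 B) λ {r} r∈ → concatMap-cong-∈ (countdown B) λ {c} c∈ →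
  let (1≤r , r<1+B) = ∈-interval⁻ 1 B r∈ ; (1≤c , c≤B) = ∈-countdown⁻ B c∈ in
  letter-cong g g′ r c (g≗g′ r c 1≤r (s≤s⁻¹ r<1+B) 1≤c c≤B)

rowWord-pad : ∀ g r {B B′} → B ≤ B′ → (∀ c → B < c → g r c ≡ false) → rowWord g B′ r ≡ rowWord g B r
rowWord-pad g r {B} {B′} B≤B′ out with countdown-split B≤B′
... | hi , eq , B<hi = begin
  concatMap (letter g r) (countdown B′)         ≡⟨ cong (concatMap (letter g r)) eq ⟩
  concatMap (letter g r) (hi ++ countdown B)    ≡⟨ concatMap-++ (letter g r) hi (countdown B) ⟩
  concatMap (letter g r) hi ++ rowWord g B r    ≡⟨ cong (_++ rowWord g B r) (concatMap-≡[] hi λ c∈ → letter-false g r _ (out _ (All.lookup B<hi c∈))) ⟩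
  rowWord g B r                                 ∎
  where open ≡-Reasoning

gridWord-pad : ∀ g {B B′} → B ≤ B′ → (∀ r c → B < r ⊎ B < c → g r c ≡ false) → gridWord g B′ ≡ gridWord g B
gridWord-pad g {B} {B′} B≤B′ out = begin
  concatMap (rowWord g B′) (interval 1 B′)
    ≡⟨ cong (concatMap (rowWord g B′) ∘ interval 1) (sym (m+[n∸m]≡n B≤B′)) ⟩
  concatMap (rowWord g B′) (interval 1 (B + (B′ ∸ B)))
    ≡⟨ cong (concatMap (rowWord g B′)) (interval-++ 1 B (B′ ∸ B)) ⟩
  concatMap (rowWord g B′) (interval 1 B ++ interval (suc B) (B′ ∸ B))
    ≡⟨ concatMap-++ (rowWord g B′) (interval 1 B) (interval (suc B) (B′ ∸ B)) ⟩
  concatMap (rowWord g B′) (interval 1 B) ++ concatMap (rowWord g B′) (interval (suc B) (B′ ∸ B))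
    ≡⟨ cong₂ _++_ (concatMap-cong-∈ (interval 1 B) λ _ → rowWord-pad g _ B≤B′ λ c B<c → out _ c (inj₂ B<c))
                  (concatMap-≡[] (interval (suc B) (B′ ∸ B)) λ r∈ →
                     concatMap-≡[] (countdown B′) λ _ → letter-false g _ _ (out _ _ (inj₁ (proj₁ (∈-interval⁻ (suc B) _ r∈))))) ⟩
  gridWord g B ++ []
    ≡⟨ ++-identityʳ _ ⟩
  gridWord g B
    ∎
  where open ≡-Reasoning

∈-bound : ∀ {r c} D → (r , c) ∈ D → r + c ≤ bound D
∈-bound (_ ∷ D) (here refl) = m≤m+n _ _
∈-bound (_ ∷ D) (there x∈)  = ≤-trans (∈-bound D x∈) (m≤n+m _ _)

occupied-outside : ∀ D r c → bound D < r ⊎ bound D < c → occupied D r c ≡ false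
occupied-outside D r c out = dec-false ((r , c) ∈? D) λ rc∈D → <⇒≱ (big out) (∈-bound D rc∈D)
  where
  big : bound D < r ⊎ bound D < c → bound D < r + c
  big (inj₁ B<r) = <-≤-trans B<r (m≤m+n r c)
  big (inj₂ B<c) = <-≤-trans B<c (m≤n+m c r)

word≡gridWord : ∀ D {B} → bound D ≤ B → word D ≡ gridWord (occupied D) B
word≡gridWord D D≤B rewrite from1≡interval (bound D) | reverse-interval (bound D) =
  sym (gridWord-pad (occupied D) D≤B (occupied-outside D))

occupied-≋ : ∀ {D E} → D ≋ E → ∀ r c → occupied D r c ≡ occupied E r c
occupied-≋ {D} {E} D≋E r c with (r , c) ∈? E
... | yes ∈E = dec-true ((r , c) ∈? D) (proj₂ (D≋E _) ∈E)
... | no ∉E  = dec-false ((r , c) ∈? D) (∉E ∘ proj₁ (D≋E _))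

word-≋ : ∀ {D E} → D ≋ E → word D ≡ word E
word-≋ {D} {E} D≋E = begin
  word D                     ≡⟨ word≡gridWord D (m≤m+n (bound D) (bound E)) ⟩
  gridWord (occupied D) B    ≡⟨ gridWord-cong B (λ r c _ _ _ _ → occupied-≋ D≋E r c) ⟩
  gridWord (occupied E) B    ≡⟨ word≡gridWord E (m≤n+m (bound E) (bound D)) ⟨
  word E                     ∎
  where
  open ≡-Reasoning
  B = bound D + bound E

prodWord-++ : ∀ u v x → prodWord (u ++ v) x ≡ prodWord u (prodWord v x)
prodWord-++ []      v x = refl
prodWord-++ (a ∷ u) v x = cong (s a) (prodWord-++ u v x)

s-cases : ∀ k x → (x ≡ k × s k x ≡ suc k) ⊎ (x ≡ suc k × s k x ≡ k) ⊎ (x ≢ k × x ≢ suc k × s k x ≡ x)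
s-cases k x with x ≡ᵇ k in e₁ | x ≡ᵇ suc k in e₂
... | true  | _     = inj₁ (≡ᵇ⇒≡ x k (subst T (sym e₁) _) , refl)
... | false | true  = inj₂ (inj₁ (≡ᵇ⇒≡ x (suc k) (subst T (sym e₂) _) , refl))
... | false | false = inj₂ (inj₂ ((λ x≡k → subst T e₁ (≡⇒≡ᵇ x k x≡k)) , (λ x≡sk → subst T e₂ (≡⇒≡ᵇ x (suc k) x≡sk)) , refl))

s-self : ∀ k → s k k ≡ suc k
s-self k with s-cases k k
... | inj₁ (_ , eq)               = eq
... | inj₂ (inj₁ (k≡sk , _))      = ⊥-elim (<⇒≢ (n<1+n k) k≡sk)
... | inj₂ (inj₂ (k≢k , _))       = ⊥-elim (k≢k refl)

s-suc : ∀ k → s k (suc k) ≡ k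
s-suc k with s-cases k (suc k)
... | inj₁ (sk≡k , _)             = ⊥-elim (>⇒≢ (n<1+n k) sk≡k)
... | inj₂ (inj₁ (_ , eq))        = eq
... | inj₂ (inj₂ (_ , sk≢sk , _)) = ⊥-elim (sk≢sk refl)

s-fix : ∀ {k x} → x ≢ k → x ≢ suc k → s k x ≡ x
s-fix {k} {x} x≢k x≢sk with s-cases k x
... | inj₁ (x≡k , _)          = ⊥-elim (x≢k x≡k)
... | inj₂ (inj₁ (x≡sk , _))  = ⊥-elim (x≢sk x≡sk)
... | inj₂ (inj₂ (_ , _ , eq)) = eq

s-fix-< : ∀ {k x} → x < k → s k x ≡ x
s-fix-< x<k = s-fix (<⇒≢ x<k) (<⇒≢ (m<n⇒m<1+n x<k))

s-fix-> : ∀ {k x} → suc k < x → s k x ≡ x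
s-fix-> sk<x = s-fix (>⇒≢ (<-trans (n<1+n _) sk<x)) (>⇒≢ sk<x)

s-comm : ∀ {a b} → suc a < b → ∀ x → s a (s b x) ≡ s b (s a x)
s-comm {a} {b} sa<b x with s-cases a x
... | inj₁ (refl , eq)
  rewrite eq | s-fix-< {b} (<-trans (n<1+n a) sa<b) | s-fix-< {b} sa<b = s-self a
... | inj₂ (inj₁ (refl , eq))
  rewrite eq | s-fix-< {b} sa<b | s-fix-< {b} (<-trans (n<1+n a) sa<b) = s-suc a
... | inj₂ (inj₂ (_ , _ , eq)) rewrite eq with s-cases b x
...   | inj₁ (refl , eq′)        rewrite eq′ = s-fix-> (s≤s (<⇒≤ sa<b))
...   | inj₂ (inj₁ (refl , eq′)) rewrite eq′ = s-fix-> sa<b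
...   | inj₂ (inj₂ (_ , _ , eq′)) rewrite eq′ = eq

Apart : ℕ → ℕ → Set
Apart k y = suc y < k ⊎ suc k < y

prodWord-s : ∀ {k} ys x → All (Apart k) ys → prodWord ys (s k x) ≡ s k (prodWord ys x)
prodWord-s []       x []           = refl
prodWord-s (y ∷ ys) x (apart ∷ as) rewrite prodWord-s ys x as with apart
... | inj₁ sy<k = s-comm sy<k (prodWord ys x)
... | inj₂ sk<y = sym (s-comm sk<y (prodWord ys x))

infix 4 _≈ʷ_
record _≈ʷ_ (u v : List ℕ) : Set where
  constructor mk≈ʷ
  field
    prodWord-≗ : ∀ x → prodWord u x ≡ prodWord v x
    length-≡   : length u ≡ length v

≈ʷ-reflexive : ∀ {u v} → u ≡ v → u ≈ʷ v
≈ʷ-reflexive refl = mk≈ʷ (λ _ → refl) refl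

≈ʷ-trans : ∀ {u v w} → u ≈ʷ v → v ≈ʷ w → u ≈ʷ w
≈ʷ-trans (mk≈ʷ u≗v |u|≡|v|) (mk≈ʷ v≗w |v|≡|w|) = mk≈ʷ (λ x → trans (u≗v x) (v≗w x)) (trans |u|≡|v| |v|≡|w|)

≈ʷ-sym : ∀ {u v} → u ≈ʷ v → v ≈ʷ u
≈ʷ-sym (mk≈ʷ u≗v |u|≡|v|) = mk≈ʷ (λ x → sym (u≗v x)) (sym |u|≡|v|)

≈ʷ-setoid : Setoid 0ℓ 0ℓ
≈ʷ-setoid = record
  { Carrier = List ℕ
  ; _≈_ = _≈ʷ_
  ; isEquivalence = record { refl = ≈ʷ-reflexive refl ; sym = ≈ʷ-sym ; trans = ≈ʷ-trans }
  }

++-cong-≈ʷ : ∀ {u u′ v v′} → u ≈ʷ u′ → v ≈ʷ v′ → u ++ v ≈ʷ u′ ++ v′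
++-cong-≈ʷ {u} {u′} {v} {v′} (mk≈ʷ u≗u′ |u|≡|u′|) (mk≈ʷ v≗v′ |v|≡|v′|) = mk≈ʷ
    (λ x → begin
      prodWord (u ++ v) x          ≡⟨ prodWord-++ u v x ⟩
      prodWord u (prodWord v x)    ≡⟨ cong (prodWord u) (v≗v′ x) ⟩
      prodWord u (prodWord v′ x)   ≡⟨ u≗u′ _ ⟩
      prodWord u′ (prodWord v′ x)  ≡⟨ prodWord-++ u′ v′ x ⟨
      prodWord (u′ ++ v′) x        ∎)
    (trans (length-++ u) (trans (cong₂ _+_ |u|≡|u′| |v|≡|v′|) (sym (length-++ u′))))
  where open ≡-Reasoning

++-congˡ-≈ʷ : ∀ u {v v′} → v ≈ʷ v′ → u ++ v ≈ʷ u ++ v′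
++-congˡ-≈ʷ u = ++-cong-≈ʷ (≈ʷ-reflexive {u} refl)

++-congʳ-≈ʷ : ∀ v {u u′} → u ≈ʷ u′ → u ++ v ≈ʷ u′ ++ v
++-congʳ-≈ʷ v u≈u′ = ++-cong-≈ʷ u≈u′ (≈ʷ-reflexive {v} refl)

-- Moving K from the second row word to the first crosses exactly the letters of L and G.
≈ʷ-slide : ∀ K H L G M → All (Apart K) L → All (Apart K) G → (H ++ K ∷ L) ++ (G ++ M) ≈ʷ (H ++ L) ++ (G ++ K ∷ M)
≈ʷ-slide K H L G M L⊥K G⊥K = mk≈ʷ same-product same-length
  where
  open ≡-Reasoning
  same-product : ∀ x → prodWord ((H ++ K ∷ L) ++ (G ++ M)) x ≡ prodWord ((H ++ L) ++ (G ++ K ∷ M)) x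
  same-product x = begin
    prodWord ((H ++ K ∷ L) ++ (G ++ M)) x                 ≡⟨ prodWord-++ (H ++ K ∷ L) (G ++ M) x ⟩
    prodWord (H ++ K ∷ L) (prodWord (G ++ M) x)           ≡⟨ prodWord-++ H (K ∷ L) _ ⟩
    prodWord H (s K (prodWord L (prodWord (G ++ M) x)))   ≡⟨ cong (prodWord H) (prodWord-s L _ L⊥K) ⟨
    prodWord H (prodWord L (s K (prodWord (G ++ M) x)))   ≡⟨ cong (λ y → prodWord H (prodWord L (s K y))) (prodWord-++ G M x) ⟩
    prodWord H (prodWord L (s K (prodWord G (prodWord M x)))) ≡⟨ cong (prodWord H ∘ prodWord L) (prodWord-s G _ G⊥K) ⟨
    prodWord H (prodWord L (prodWord G (s K (prodWord M x)))) ≡⟨ cong (prodWord H ∘ prodWord L) (prodWord-++ G (K ∷ M) x) ⟨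
    prodWord H (prodWord L (prodWord (G ++ K ∷ M) x))     ≡⟨ prodWord-++ H L _ ⟨
    prodWord (H ++ L) (prodWord (G ++ K ∷ M) x)           ≡⟨ prodWord-++ (H ++ L) (G ++ K ∷ M) x ⟨
    prodWord ((H ++ L) ++ (G ++ K ∷ M)) x                 ∎
  same-length : length ((H ++ K ∷ L) ++ (G ++ M)) ≡ length ((H ++ L) ++ (G ++ K ∷ M))
  same-length rewrite length-++ (H ++ K ∷ L) {G ++ M} | length-++ H {K ∷ L} | length-++ G {M}
            | length-++ (H ++ L) {G ++ K ∷ M} | length-++ H {L} | length-++ G {K ∷ M}
            | +-suc (length H) (length L) | +-suc (length G) (length M) =
    sym (+-suc (length H + length L) (length G + length M))

-- The cell (r₀+2, c₀+1) of g moves to (r₀+1, c₀+2) in g′; the letter r₀ + c₀ + 2 of both cells is K.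
module _ (g g′ : Grid) (B r₀ c₀ : ℕ) (sr≤B : suc (suc r₀) ≤ B) (sc≤B : suc (suc c₀) ≤ B)
         (agree : ∀ r′ c′ → (r′ , c′) ≢ (suc r₀ , suc (suc c₀)) → (r′ , c′) ≢ (suc (suc r₀) , suc c₀) → g′ r′ c′ ≡ g r′ c′)
         where
  private
    r c K : ℕ
    r = suc r₀
    c = suc c₀
    K = suc (r₀ + c)

    k = B ∸ suc r
    post = interval (suc (suc r)) k

    rows : interval 1 B ≡ interval 1 r₀ ++ r ∷ suc r ∷ post
    rows = trans (cong (interval 1) (sym B≡)) (interval-++ 1 r₀ (2 + k))
      where
      B≡ : r₀ + (2 + k) ≡ B
      B≡ = trans (+-suc r₀ (suc k)) (trans (cong suc (+-suc r₀ k)) (m+[n∸m]≡n sr≤B))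

    above below : Grid → List ℕ
    above h = concatMap (rowWord h B) (interval 1 r₀)
    below h = concatMap (rowWord h B) post

    gridWord-around : ∀ h → gridWord h B ≡ above h ++ (rowWord h B r ++ rowWord h B (suc r)) ++ below h
    gridWord-around h = trans (cong (concatMap (rowWord h B)) rows)
      (trans (concatMap-++ (rowWord h B) (interval 1 r₀) (r ∷ suc r ∷ post))
             (cong (above h ++_) (sym (++-assoc (rowWord h B r) (rowWord h B (suc r)) (below h)))))

    hi = proj₁ (countdown-split sc≤B)

    c<hi : All (suc c <_) hi
    c<hi = proj₂ (proj₂ (countdown-split sc≤B))

    right left : Grid → ℕ → List ℕ
    right h r′ = concatMap (letter h r′) hi
    left h r′ = concatMap (letter h r′) (countdown c₀)

    rowWord-around : ∀ h r′ → rowWord h B r′ ≡ right h r′ ++ letter h r′ (suc c) ++ letter h r′ c ++ left h r′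
    rowWord-around h r′ = trans (cong (concatMap (letter h r′)) (proj₁ (proj₂ (countdown-split sc≤B))))
                                (concatMap-++ (letter h r′) hi (countdown (suc c)))

    rowWord-agree : ∀ {r′} → r′ ≢ r → r′ ≢ suc r → rowWord g′ B r′ ≡ rowWord g B r′
    rowWord-agree r′≢r r′≢sr = concatMap-cong (λ c′ →
      letter-cong g′ g _ c′ (agree _ c′ (r′≢r ∘ cong proj₁) (r′≢sr ∘ cong proj₁))) (countdown B)

    above-agree : above g′ ≡ above g
    above-agree = concatMap-cong-∈ (interval 1 r₀) λ r′∈ →
      let r′<r = proj₂ (∈-interval⁻ 1 r₀ r′∈) in rowWord-agree (<⇒≢ r′<r) (<⇒≢ (m<n⇒m<1+n r′<r))

    below-agree : below g′ ≡ below g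
    below-agree = concatMap-cong-∈ post λ r′∈ →
      let sr<r′ = proj₁ (∈-interval⁻ (suc (suc r)) k r′∈) in rowWord-agree (>⇒≢ (<-trans (n<1+n r) sr<r′)) (>⇒≢ sr<r′)

    columns-agree : ∀ r′ cs → All (λ c′ → c′ ≢ c × c′ ≢ suc c) cs → concatMap (letter g′ r′) cs ≡ concatMap (letter g r′) cs
    columns-agree r′ cs away = concatMap-cong-∈ cs λ c′∈ → let (c′≢c , c′≢sc) = All.lookup away c′∈ in
      letter-cong g′ g r′ _ (agree r′ _ (c′≢sc ∘ cong proj₂) (c′≢c ∘ cong proj₂))

    right-agree : ∀ r′ → right g′ r′ ≡ right g r′
    right-agree r′ = columns-agree r′ hi (All.map (λ sc<c′ → >⇒≢ (<-trans (n<1+n c) sc<c′) , >⇒≢ sc<c′) c<hi)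

    left-agree : ∀ r′ → left g′ r′ ≡ left g r′
    left-agree r′ = columns-agree r′ (countdown c₀) (All.tabulate λ c′∈ →
      let c′<c = s≤s (proj₂ (∈-countdown⁻ c₀ c′∈)) in <⇒≢ c′<c , <⇒≢ (m<n⇒m<1+n c′<c))

    left-apart : All (Apart K) (left g r)
    left-apart = letters-All (Apart K) g r (countdown c₀) λ c′∈ →
      inj₁ (s≤s (+-monoʳ-< r₀ (s≤s (proj₂ (∈-countdown⁻ c₀ c′∈)))))

    right-apart : All (Apart K) (right g (suc r))
    right-apart = letters-All (Apart K) g (suc r) hi λ c′∈ →
      inj₂ (s≤s (≤-trans (≤-reflexive (sym (trans (+-suc r₀ (suc c)) (cong suc (+-suc r₀ c)))))
                         (+-monoʳ-≤ r₀ (All.lookup c<hi c′∈))))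

  gridWord-ladder :
      g r c ≡ false → g r (suc c) ≡ false → g (suc r) c ≡ true → g (suc r) (suc c) ≡ false
    → g′ r (suc c) ≡ true → g′ (suc r) c ≡ false
    → gridWord g′ B ≈ʷ gridWord g B
  gridWord-ladder g-r-c g-r-sc g-sr-c g-sr-sc g′-r-sc g′-sr-c = begin
    gridWord g′ B
      ≡⟨ gridWord-around g′ ⟩
    above g′ ++ (rowWord g′ B r ++ rowWord g′ B (suc r)) ++ below g′
      ≡⟨ cong₂ _++_ above-agree (cong₂ _++_ (cong₂ _++_ row-r′ row-sr′) below-agree) ⟩
    above g ++ ((right g r ++ K ∷ left g r) ++ (right g (suc r) ++ left g (suc r))) ++ below g
      ≈⟨ ++-congˡ-≈ʷ (above g) (++-congʳ-≈ʷ (below g)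
           (≈ʷ-slide K (right g r) (left g r) (right g (suc r)) (left g (suc r)) left-apart right-apart)) ⟩
    above g ++ ((right g r ++ left g r) ++ (right g (suc r) ++ K ∷ left g (suc r))) ++ below g
      ≡⟨ cong (λ u → above g ++ u ++ below g) (cong₂ _++_ row-r row-sr) ⟨
    above g ++ (rowWord g B r ++ rowWord g B (suc r)) ++ below g
      ≡⟨ gridWord-around g ⟨
    gridWord g B
      ∎
    where
    open import Relation.Binary.Reasoning.Setoid ≈ʷ-setoid

    g′-r-c : g′ r c ≡ false
    g′-r-c = trans (agree r c (λ eq → <⇒≢ (n<1+n c) (cong proj₂ eq)) (λ eq → <⇒≢ (n<1+n r) (cong proj₁ eq))) g-r-c

    g′-sr-sc : g′ (suc r) (suc c) ≡ false
    g′-sr-sc = trans (agree (suc r) (suc c) (λ eq → >⇒≢ (n<1+n r) (cong proj₁ eq)) (λ eq → >⇒≢ (n<1+n c) (cong proj₂ eq))) g-sr-sc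

    row-r : rowWord g B r ≡ right g r ++ left g r
    row-r rewrite rowWord-around g r | g-r-sc | g-r-c = refl

    row-sr : rowWord g B (suc r) ≡ right g (suc r) ++ K ∷ left g (suc r)
    row-sr rewrite rowWord-around g (suc r) | g-sr-sc | g-sr-c = refl

    row-r′ : rowWord g′ B r ≡ right g r ++ K ∷ left g r
    row-r′ rewrite rowWord-around g′ r | g′-r-sc | g′-r-c | right-agree r | left-agree r | +-suc r₀ c = refl

    row-sr′ : rowWord g′ B (suc r) ≡ right g (suc r) ++ left g (suc r)
    row-sr′ rewrite rowWord-around g′ (suc r) | g′-sr-sc | g′-sr-c | right-agree (suc r) | left-agree (suc r) = refl

reduced-≈ʷ : ∀ {n} (w : Permutation′ n) {D E} → All Positive E → word E ≈ʷ word D → IsReducedPD w D → IsReducedPD w E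
reduced-≈ʷ w E⁺ (mk≈ʷ same-product same-length) (_ , product≡w , length≡ℓ) =
  E⁺ , (λ x → trans (same-product x) (product≡w x)) , trans same-length length≡ℓ

reduced-≋ : ∀ {n} (w : Permutation′ n) {D E} → D ≋ E → IsReducedPD w D → IsReducedPD w E
reduced-≋ w D≋E D-reduced@(D⁺ , _) =
  reduced-≈ʷ w (All.tabulate λ x∈E → All.lookup D⁺ (proj₂ (D≋E _) x∈E)) (≈ʷ-reflexive (sym (word-≋ D≋E))) D-reduced

ladder-positive : ∀ {D E} → All Positive D → LadderMove D E → All Positive E
ladder-positive D⁺ (r , c , 1≤r , _ , _ , _ , _ , moved) = All.tabulate λ {x} x∈E →
  [ (λ (x∈D , _) → All.lookup D⁺ x∈D) , (λ { refl → 1≤r , s≤s z≤n }) ]′ (proj₁ (moved x) x∈E)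

word-ladder : ∀ {D E} → All Positive D → LadderMove D E → word E ≈ʷ word D
word-ladder D⁺ (zero , _ , () , _)
word-ladder D⁺ (suc r₀ , zero , _ , lower∈D , _) = ⊥-elim (n≮0 (proj₂ (All.lookup D⁺ lower∈D)))
word-ladder {D} {E} D⁺ (suc r₀ , suc c₀ , _ , lower∈D , r-c∉D , r-sc∉D , sr-sc∉D , moved) = begin
  word E                   ≡⟨ word≡gridWord E (m≤n+m (bound E) (bound D)) ⟩
  gridWord (occupied E) B  ≈⟨ gridWord-ladder (occupied D) (occupied E) B r₀ c₀ sr≤B sc≤B agree
                                (dec-false ((r , c) ∈? D) r-c∉D) (dec-false ((r , suc c) ∈? D) r-sc∉D)
                                (dec-true ((suc r , c) ∈? D) lower∈D) (dec-false ((suc r , suc c) ∈? D) sr-sc∉D)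
                                (dec-true ((r , suc c) ∈? E) upper∈E) (dec-false ((suc r , c) ∈? E) lower∉E) ⟩
  gridWord (occupied D) B  ≡⟨ word≡gridWord D (m≤m+n (bound D) (bound E)) ⟨
  word D                   ∎
  where
  open import Relation.Binary.Reasoning.Setoid ≈ʷ-setoid
  r = suc r₀
  c = suc c₀
  B = bound D + bound E

  upper∈E : (r , suc c) ∈ E
  upper∈E = proj₂ (moved _) (inj₂ refl)

  lower∉E : (suc r , c) ∉ E
  lower∉E lower∈E = [ (λ (_ , ≢lower) → ≢lower refl) , (λ eq → 1+n≢n (cong proj₁ eq)) ]′ (proj₁ (moved _) lower∈E)

  sr≤B : suc r ≤ B
  sr≤B = ≤-trans (m≤m+n (suc r) c) (≤-trans (∈-bound D lower∈D) (m≤m+n (bound D) (bound E)))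

  sc≤B : suc c ≤ B
  sc≤B = ≤-trans (m≤n+m (suc c) r) (≤-trans (∈-bound E upper∈E) (m≤n+m (bound E) (bound D)))

  agree : ∀ r′ c′ → (r′ , c′) ≢ (r , suc c) → (r′ , c′) ≢ (suc r , c) → occupied E r′ c′ ≡ occupied D r′ c′
  agree r′ c′ ≢upper ≢lower with (r′ , c′) ∈? D
  ... | yes ∈D = dec-true ((r′ , c′) ∈? E) (proj₂ (moved _) (inj₁ (∈D , ≢lower)))
  ... | no ∉D  = dec-false ((r′ , c′) ∈? E) λ ∈E → [ ∉D ∘ proj₁ , ≢upper ]′ (proj₁ (moved _) ∈E)

reduced-ladder : ∀ {n} (w : Permutation′ n) {D E} → LadderMove D E → IsReducedPD w D → IsReducedPD w E
reduced-ladder w D→E D-reduced@(D⁺ , _) = reduced-≈ʷ w (ladder-positive D⁺ D→E) (word-ladder D⁺ D→E) D-reduced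

reduced-star : ∀ {n} (w : Permutation′ n) {D E} → Star LadderMove D E → IsReducedPD w D → IsReducedPD w E
reduced-star w ε            = id
reduced-star w (D→D′ ◅ D′→*E) = reduced-star w D′→*E ∘ reduced-ladder w D→D′

module _ {P Q : A → Set} (P? : Decidable P) (Q? : Decidable Q) (P⇒Q : ∀ {x} → P x → Q x) where

  length-filter-mono : ∀ xs → length (filter P? xs) ≤ length (filter Q? xs)
  length-filter-mono []       = z≤n
  length-filter-mono (x ∷ xs) with P? x | Q? x
  ... | yes _  | yes _  = s≤s (length-filter-mono xs)
  ... | yes px | no ¬qx = ⊥-elim (¬qx (P⇒Q px))
  ... | no _   | yes _  = m≤n⇒m≤1+n (length-filter-mono xs)
  ... | no _   | no _   = length-filter-mono xs

  length-filter-mono-< : ∀ {x₀ xs} → x₀ ∈ xs → Q x₀ → ¬ P x₀ → length (filter P? xs) < length (filter Q? xs)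
  length-filter-mono-< {xs = x ∷ xs} (here refl) qx ¬px with P? x | Q? x
  ... | yes px | _      = ⊥-elim (¬px px)
  ... | no _   | yes _  = s≤s (length-filter-mono xs)
  ... | no _   | no ¬qx = ⊥-elim (¬qx qx)
  length-filter-mono-< {xs = x ∷ xs} (there x₀∈) qx₀ ¬px₀ with P? x | Q? x
  ... | yes _  | yes _  = s≤s (length-filter-mono-< x₀∈ qx₀ ¬px₀)
  ... | yes px | no ¬qx = ⊥-elim (¬qx (P⇒Q px))
  ... | no _   | yes _  = m≤n⇒m≤1+n (length-filter-mono-< x₀∈ qx₀ ¬px₀)
  ... | no _   | no _   = length-filter-mono-< x₀∈ qx₀ ¬px₀

length-filter-tabulate : ∀ {n} {P : A → Set} (P? : Decidable P) (f : Fin n → A) →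
  length (filter P? (tabulate f)) ≡ FinSum.sum (λ i → if does (P? (f i)) then 1 else 0)
length-filter-tabulate {n = zero}  P? f = refl
length-filter-tabulate {n = suc n} P? f with does (P? (f fzero))
... | true  = cong suc (length-filter-tabulate P? (f ∘ fsuc))
... | false = length-filter-tabulate P? (f ∘ fsuc)

interval≡tabulate : ∀ a n → interval a n ≡ tabulate {n = n} (λ i → a + toℕ i)
interval≡tabulate a zero    = refl
interval≡tabulate a (suc n) = cong₂ _∷_ (sym (+-identityʳ a))
  (trans (interval≡tabulate (suc a) n) (tabulate-cong (λ i → sym (+-suc a (toℕ i)))))

map-+-interval : ∀ k a n → map (k +_) (interval a n) ≡ interval (k + a) n
map-+-interval k a zero    = refl
map-+-interval k a (suc n) = cong (k + a ∷_) (trans (map-+-interval k (suc a) n) (cong (λ b → interval b n) (+-suc k a)))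

length-filter-<-interval : ∀ a m {V} → a ≤ V → V ≤ a + m → length (filter (_<? V) (interval a m)) ≡ V ∸ a
length-filter-<-interval a zero    {V} _   V≤a+0 = sym (m≤n⇒m∸n≡0 (subst (V ≤_) (+-identityʳ a) V≤a+0))
length-filter-<-interval a (suc m) {V} a≤V V≤a+m with a <? V
... | yes a<V = begin
  length (filter (_<? V) (a ∷ interval (suc a) m))  ≡⟨ cong length (filter-accept (_<? V) a<V) ⟩
  suc (length (filter (_<? V) (interval (suc a) m))) ≡⟨ cong suc (length-filter-<-interval (suc a) m a<V (subst (V ≤_) (+-suc a m) V≤a+m)) ⟩
  suc (V ∸ suc a)                                    ≡⟨ +-∸-assoc 1 a<V ⟨
  V ∸ a                                              ∎
  where open ≡-Reasoning
... | no a≮V = begin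
  length (filter (_<? V) (a ∷ interval (suc a) m))  ≡⟨ cong length (filter-reject (_<? V) a≮V) ⟩
  length (filter (_<? V) (interval (suc a) m))       ≡⟨ cong length (filter-none (_<? V) (All.tabulate λ y∈ y<V →
                                                          a≮V (<-≤-trans (proj₁ (∈-interval⁻ (suc a) m y∈)) (<⇒≤ y<V)))) ⟩
  0                                                  ≡⟨ m≤n⇒m∸n≡0 (≮⇒≥ a≮V) ⟨
  V ∸ a                                              ∎
  where open ≡-Reasoning

module _ {n} (w : Permutation′ n) where

  ext-fin : ∀ (i : Fin n) → ext w (suc (toℕ i)) ≡ suc (toℕ (w ⟨$⟩ʳ i))
  ext-fin i with toℕ i <? n
  ... | yes i<n = cong (λ j → suc (toℕ (w ⟨$⟩ʳ j))) (Fin.fromℕ<-toℕ i i<n)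
  ... | no i≮n  = ⊥-elim (i≮n (Fin.toℕ<n i))

  ext-out : ∀ {x} → n < x → ext w x ≡ x
  ext-out {suc i} n<x with i <? n
  ... | yes i<n = ⊥-elim (<⇒≱ i<n (s≤s⁻¹ n<x))
  ... | no _    = refl

  ext-range : ∀ {x} → 1 ≤ x → x ≤ n → 1 ≤ ext w x × ext w x ≤ n
  ext-range {suc i} _ x≤n with i <? n
  ... | yes _   = s≤s z≤n , Fin.toℕ<n _
  ... | no i≮n  = ⊥-elim (i≮n x≤n)

  ext-suc≢0 : ∀ i → ext w (suc i) ≢ 0
  ext-suc≢0 i with i <? n
  ... | yes _ = λ ()
  ... | no _  = λ ()

  ext-injective : ∀ {x y} → ext w x ≡ ext w y → x ≡ y
  ext-injective {zero}  {zero}  _  = refl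
  ext-injective {zero}  {suc j} eq = ⊥-elim (ext-suc≢0 j (sym eq))
  ext-injective {suc i} {zero}  eq = ⊥-elim (ext-suc≢0 i eq)
  ext-injective {suc i} {suc j} eq with i <? n | j <? n
  ... | yes i<n | yes j<n = cong suc (Fin.fromℕ<-injective i j i<n j<n
          (trans (sym (inverseˡ w)) (trans (cong (w ⟨$⟩ˡ_) (Fin.toℕ-injective (suc-injective eq))) (inverseˡ w))))
  ... | yes i<n | no j≮n  = ⊥-elim (j≮n (subst (_< n) (suc-injective eq) (Fin.toℕ<n _)))
  ... | no i≮n  | yes j<n = ⊥-elim (i≮n (subst (_< n) (sym (suc-injective eq)) (Fin.toℕ<n _)))
  ... | no _    | no _    = eq

  count-ext-< : ∀ V → length (filter (λ y → ext w y <? V) (interval 1 n)) ≡ length (filter (_<? V) (interval 1 n))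
  count-ext-< V = begin
    length (filter (λ y → ext w y <? V) (interval 1 n))
      ≡⟨ cong (length ∘ filter (λ y → ext w y <? V)) (interval≡tabulate 1 n) ⟩
    length (filter (λ y → ext w y <? V) (tabulate {n = n} (λ i → suc (toℕ i))))
      ≡⟨ length-filter-tabulate {n = n} (λ y → ext w y <? V) (λ i → suc (toℕ i)) ⟩
    FinSum.sum {n} (λ i → indicator (ext w (suc (toℕ i))))
      ≡⟨ FinSum.sum-cong-≗ (λ i → cong indicator (ext-fin i)) ⟩
    FinSum.sum {n} (λ i → indicator (suc (toℕ (w ⟨$⟩ʳ i))))
      ≡⟨ FinSum.sum-permute (λ i → indicator (suc (toℕ i))) w ⟨
    FinSum.sum {n} (λ i → indicator (suc (toℕ i)))
      ≡⟨ length-filter-tabulate {n = n} (_<? V) (λ i → suc (toℕ i)) ⟨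
    length (filter (_<? V) (tabulate {n = n} (λ i → suc (toℕ i))))
      ≡⟨ cong (length ∘ filter (_<? V)) (interval≡tabulate 1 n) ⟨
    length (filter (_<? V) (interval 1 n))
      ∎
    where
    open ≡-Reasoning
    indicator : ℕ → ℕ
    indicator y = if does (y <? V) then 1 else 0

  count-smaller : ∀ {x} → 1 ≤ x → x ≤ n → length (filter (λ y → ext w y <? ext w x) (interval 1 n)) ≡ ext w x ∸ 1
  count-smaller 1≤x x≤n = let (1≤wx , wx≤n) = ext-range 1≤x x≤n in
    trans (count-ext-< _) (length-filter-<-interval 1 n 1≤wx (m≤n⇒m≤1+n wx≤n))

rowLetters : ℕ → ℕ → List ℕ
rowLetters r l = map (λ c → r + c ∸ 1) (countdown l)

-- A full row of length l starting at column 1 of row k₀ + 1 acts as the cycle k₀+1 ↦ k₀+1+l ↦ k₀+l ↦ ⋯ ↦ k₀+1.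
rowLetters-fix-< : ∀ k₀ l {x} → x ≤ k₀ → prodWord (rowLetters (suc k₀) l) x ≡ x
rowLetters-fix-< k₀ zero    x≤k₀ = refl
rowLetters-fix-< k₀ (suc l) x≤k₀ rewrite rowLetters-fix-< k₀ l x≤k₀ =
  s-fix-< (≤-trans (s≤s x≤k₀) (≤-trans (s≤s (m≤m+n k₀ l)) (≤-reflexive (sym (+-suc k₀ l)))))

rowLetters-fix-> : ∀ k₀ l {x} → suc k₀ + l < x → prodWord (rowLetters (suc k₀) l) x ≡ x
rowLetters-fix-> k₀ zero    _ = refl
rowLetters-fix-> k₀ (suc l) k+l<x rewrite rowLetters-fix-> k₀ l (≤-trans (s≤s (+-monoʳ-≤ (suc k₀) (n≤1+n l))) k+l<x) =
  s-fix-> k+l<x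

rowLetters-first : ∀ k₀ l → prodWord (rowLetters (suc k₀) l) (suc k₀) ≡ suc k₀ + l
rowLetters-first k₀ zero    = cong suc (sym (+-identityʳ k₀))
rowLetters-first k₀ (suc l) =
  trans (cong (s (k₀ + suc l)) (trans (rowLetters-first k₀ l) (sym (+-suc k₀ l)))) (s-self (k₀ + suc l))

rowLetters-pred : ∀ k₀ l {x} → k₀ < x → x ≤ k₀ + l → prodWord (rowLetters (suc k₀) l) (suc x) ≡ x
rowLetters-pred k₀ zero    {x} k₀<x x≤k₀+0 = ⊥-elim (<⇒≱ k₀<x (subst (x ≤_) (+-identityʳ k₀) x≤k₀+0))
rowLetters-pred k₀ (suc l) {x} k₀<x x≤k₀+sl with x ≤? k₀ + l
... | yes x≤k₀+l rewrite rowLetters-pred k₀ l k₀<x x≤k₀+l =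
  s-fix-< (≤-trans (s≤s x≤k₀+l) (≤-reflexive (sym (+-suc k₀ l))))
... | no x≰k₀+l
  rewrite rowLetters-fix-> k₀ l (s≤s (≰⇒> x≰k₀+l))
        | ≤-antisym x≤k₀+sl (subst (_≤ x) (sym (+-suc k₀ l)) (≰⇒> x≰k₀+l)) = s-suc (k₀ + suc l)

module _ {n} (w : Permutation′ n) where
  private
    L : ℕ → ℕ
    L = codeW w

  countFrom : ℕ → ℕ → ℕ → ℕ
  countFrom k m x = length (filter (λ y → ext w y <? ext w x) (interval k m))

  codeW≡countFrom : ∀ k → L k ≡ countFrom (suc k) (n ∸ k) k
  codeW≡countFrom k = cong (length ∘ filter (λ y → ext w y <? ext w k)) (begin
    map (k +_) (from1 (n ∸ k))       ≡⟨ cong (map (k +_)) (from1≡interval (n ∸ k)) ⟩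
    map (k +_) (interval 1 (n ∸ k))  ≡⟨ map-+-interval k 1 (n ∸ k) ⟩
    interval (k + 1) (n ∸ k)         ≡⟨ cong (λ a → interval a (n ∸ k)) (+-comm k 1) ⟩
    interval (suc k) (n ∸ k)         ∎)
    where open ≡-Reasoning

  codeW≤ : ∀ k → L k ≤ n ∸ k
  codeW≤ k = ≤-trans (length-filter (λ y → ext w y <? ext w k) (map (k +_) (from1 (n ∸ k))))
                     (≤-reflexive (trans (length-map (k +_) (from1 (n ∸ k)))
                                  (trans (length-map suc (upTo (n ∸ k))) (length-upTo (n ∸ k)))))

  codeW-bound : ∀ {k} → k ≤ n → k + L k ≤ n
  codeW-bound {k} k≤n = ≤-trans (+-monoʳ-≤ k (codeW≤ k)) (≤-reflexive (m+[n∸m]≡n k≤n))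

  codeW-out : ∀ {k} → n < k → L k ≡ 0
  codeW-out {k} n<k = cong (λ m → length (filter (λ y → ext w y <? ext w k) (map (k +_) (from1 m)))) (m≤n⇒m∸n≡0 (<⇒≤ n<k))

  bottomWord : ℕ → ℕ → List ℕ
  bottomWord k m = concatMap (λ r → rowLetters r (L r)) (interval k m)

  module _ (m k₀ : ℕ) (last : suc k₀ + suc m ≡ suc n) where
    private
      k = suc k₀
      k+m≡n : k + m ≡ n
      k+m≡n = trans (sym (+-suc k₀ m)) (suc-injective last)

    next-last : suc k + m ≡ suc n
    next-last = cong suc k+m≡n

    first-row≤n : k ≤ n
    first-row≤n = subst (k ≤_) k+m≡n (m≤m+n k m)

    codeW≡countFrom-window : L k ≡ countFrom (suc k) m k
    codeW≡countFrom-window = trans (codeW≡countFrom k)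
      (cong (λ j → countFrom (suc k) j k) (trans (cong (_∸ k) (sym k+m≡n)) (m+n∸m≡n k m)))

  bottomWord-∷ : ∀ k m x → prodWord (bottomWord k (suc m)) x ≡ prodWord (rowLetters k (L k)) (prodWord (bottomWord (suc k) m) x)
  bottomWord-∷ k m = prodWord-++ (rowLetters k (L k)) (bottomWord (suc k) m)

  countFrom-∷-< : ∀ k m x → ext w k < ext w x → countFrom k (suc m) x ≡ suc (countFrom (suc k) m x)
  countFrom-∷-< k m x = cong length ∘ filter-accept (λ y → ext w y <? ext w x) {xs = interval (suc k) m}

  countFrom-∷-≮ : ∀ k m x → ext w k ≮ ext w x → countFrom k (suc m) x ≡ countFrom (suc k) m x
  countFrom-∷-≮ k m x = cong length ∘ filter-reject (λ y → ext w y <? ext w x) {xs = interval (suc k) m}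

  bottomWord-fix : ∀ m k₀ → suc k₀ + m ≡ suc n → ∀ {x} → x ≤ k₀ ⊎ n < x → prodWord (bottomWord (suc k₀) m) x ≡ x
  bottomWord-fix zero    k₀ _    _ = refl
  bottomWord-fix (suc m) k₀ last {x} outside = begin
    prodWord (bottomWord k (suc m)) x                       ≡⟨ bottomWord-∷ k m x ⟩
    prodWord row (prodWord (bottomWord (suc k) m) x)        ≡⟨ cong (prodWord row) (bottomWord-fix m k (next-last m k₀ last) outside′) ⟩
    prodWord row x                                          ≡⟨ row-fix outside ⟩
    x                                                       ∎
    where
    open ≡-Reasoning
    k = suc k₀
    row = rowLetters k (L k)
    outside′ : x ≤ k ⊎ n < x
    outside′ = [ inj₁ ∘ m≤n⇒m≤1+n , inj₂ ]′ outside
    row-fix : x ≤ k₀ ⊎ n < x → prodWord row x ≡ x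
    row-fix (inj₁ x≤k₀) = rowLetters-fix-< k₀ (L k) x≤k₀
    row-fix (inj₂ n<x)  = rowLetters-fix-> k₀ (L k) (≤-<-trans (codeW-bound (first-row≤n m k₀ last)) n<x)

  bottomWord-count : ∀ m k₀ → suc k₀ + m ≡ suc n → ∀ {x} → suc k₀ ≤ x → x ≤ n →
                     prodWord (bottomWord (suc k₀) m) x ≡ suc k₀ + countFrom (suc k₀) m x
  bottomWord-count zero    k₀ last {x} k≤x x≤n =
    ⊥-elim (<⇒≱ (s≤s x≤n) (subst (_≤ x) (trans (cong suc (sym (+-identityʳ k₀))) last) k≤x))
  bottomWord-count (suc m) k₀ last {x} k≤x x≤n with x ≟ suc k₀
  ... | yes refl = begin
    prodWord (bottomWord k (suc m)) k                 ≡⟨ bottomWord-∷ k m k ⟩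
    prodWord row (prodWord (bottomWord (suc k) m) k)  ≡⟨ cong (prodWord row) (bottomWord-fix m k (next-last m k₀ last) (inj₁ ≤-refl)) ⟩
    prodWord row k                                    ≡⟨ rowLetters-first k₀ (L k) ⟩
    k + L k                                           ≡⟨ cong (k +_) (codeW≡countFrom-window m k₀ last) ⟩
    k + countFrom (suc k) m k                         ≡⟨ cong (k +_) (countFrom-∷-≮ k m k (<-irrefl refl)) ⟨
    k + countFrom k (suc m) k                         ∎
    where
    open ≡-Reasoning
    k = suc k₀
    row = rowLetters k (L k)
  ... | no x≢k = begin
    prodWord (bottomWord k (suc m)) x                 ≡⟨ bottomWord-∷ k m x ⟩
    prodWord row (prodWord (bottomWord (suc k) m) x)  ≡⟨ cong (prodWord row) (bottomWord-count m k (next-last m k₀ last) k<x x≤n) ⟩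
    prodWord row (suc k + c′)                         ≡⟨ first-row (ext w k <? ext w x) ⟩
    k + countFrom k (suc m) x                         ∎
    where
    open ≡-Reasoning
    k = suc k₀
    row = rowLetters k (L k)
    k<x : k < x
    k<x = ≤∧≢⇒< k≤x (x≢k ∘ sym)
    c′ = countFrom (suc k) m x
    L≡ = codeW≡countFrom-window m k₀ last
    first-row : Dec (ext w k < ext w x) → prodWord row (suc k + c′) ≡ k + countFrom k (suc m) x
    first-row (yes wk<wx) = begin
      prodWord row (suc k + c′)  ≡⟨ rowLetters-fix-> k₀ (L k) (s≤s (+-monoʳ-≤ k L≤c′)) ⟩
      suc k + c′                 ≡⟨ +-suc k c′ ⟨
      k + suc c′                 ≡⟨ cong (k +_) (countFrom-∷-< k m x wk<wx) ⟨
      k + countFrom k (suc m) x  ∎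
      where
      L≤c′ : L k ≤ c′
      L≤c′ = subst (_≤ c′) (sym L≡) (length-filter-mono (λ y → ext w y <? ext w k) (λ y → ext w y <? ext w x)
                                       (λ wy<wk → <-trans wy<wk wk<wx) (interval (suc k) m))
    first-row (no wk≮wx) = begin
      prodWord row (suc k + c′)  ≡⟨ rowLetters-pred k₀ (L k) (s≤s (m≤m+n k₀ c′)) (+-monoʳ-< k₀ c′<L) ⟩
      k + c′                     ≡⟨ cong (k +_) (countFrom-∷-≮ k m x wk≮wx) ⟨
      k + countFrom k (suc m) x  ∎
      where
      wx<wk : ext w x < ext w k
      wx<wk = ≤∧≢⇒< (≮⇒≥ wk≮wx) (x≢k ∘ ext-injective w)
      x∈ : x ∈ interval (suc k) m
      x∈ = ∈-interval⁺ (suc k) m k<x (subst (x <_) (sym (next-last m k₀ last)) (s≤s x≤n))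
      c′<L : c′ < L k
      c′<L = subst (c′ <_) (sym L≡) (length-filter-mono-< (λ y → ext w y <? ext w x) (λ y → ext w y <? ext w k)
                                       (λ wy<wx → <-trans wy<wx wx<wk) x∈ wx<wk (<-irrefl refl))

  prodWord-bottomWord : ∀ x → prodWord (bottomWord 1 n) x ≡ ext w x
  prodWord-bottomWord zero = bottomWord-fix n 0 refl (inj₁ z≤n)
  prodWord-bottomWord (suc i) = by-range (suc i ≤? n)
    where
    open ≡-Reasoning
    by-range : Dec (suc i ≤ n) → prodWord (bottomWord 1 n) (suc i) ≡ ext w (suc i)
    by-range (yes x≤n) = begin
      prodWord (bottomWord 1 n) (suc i)  ≡⟨ bottomWord-count n 0 refl (s≤s z≤n) x≤n ⟩
      1 + countFrom 1 n (suc i)          ≡⟨ cong suc (count-smaller w (s≤s z≤n) x≤n) ⟩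
      1 + (ext w (suc i) ∸ 1)            ≡⟨ m+[n∸m]≡n (proj₁ (ext-range w (s≤s z≤n) x≤n)) ⟩
      ext w (suc i)                      ∎
    by-range (no x≰n) = trans (bottomWord-fix n 0 refl (inj₂ (≰⇒> x≰n))) (sym (ext-out w (≰⇒> x≰n)))

  bottomWord-pad : ∀ k → bottomWord 1 (n + k) ≡ bottomWord 1 n
  bottomWord-pad k = begin
    concatMap row (interval 1 (n + k))                          ≡⟨ cong (concatMap row) (interval-++ 1 n k) ⟩
    concatMap row (interval 1 n ++ interval (suc n) k)          ≡⟨ concatMap-++ row (interval 1 n) (interval (suc n) k) ⟩
    bottomWord 1 n ++ concatMap row (interval (suc n) k)        ≡⟨ cong (bottomWord 1 n ++_) (concatMap-≡[] (interval (suc n) k) empty-row) ⟩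
    bottomWord 1 n ++ []                                        ≡⟨ ++-identityʳ _ ⟩
    bottomWord 1 n                                              ∎
    where
    open ≡-Reasoning
    row = λ r → rowLetters r (L r)
    empty-row : ∀ {r} → r ∈ interval (suc n) k → row r ≡ []
    empty-row {r} r∈ = cong (rowLetters r) (codeW-out (proj₁ (∈-interval⁻ (suc n) k r∈)))

  length-bottomWord : ∀ a m → length (bottomWord a m) ≡ sum (map L (interval a m))
  length-bottomWord a zero    = refl
  length-bottomWord a (suc m) = trans (length-++ (rowLetters a (L a)))
    (cong₂ _+_ (trans (length-map _ (countdown (L a))) (length-countdown (L a))) (length-bottomWord (suc a) m))

  ∈-Pbott⁻ : ∀ {r c} → (r , c) ∈ Pbott w → 1 ≤ r × 1 ≤ c × c ≤ L r
  ∈-Pbott⁻ rc∈ with find (∈-concatMap⁻ (λ i → map (i ,_) (from1 (L i))) {xs = from1 n} rc∈)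
  ... | i , i∈ , rc∈row with ∈-map⁻ (i ,_) rc∈row
  ... | c , c∈ , refl = proj₁ (∈-from1⁻ n i∈) , ∈-from1⁻ (L i) c∈

  ∈-Pbott⁺ : ∀ {r c} → 1 ≤ r → 1 ≤ c → c ≤ L r → (r , c) ∈ Pbott w
  ∈-Pbott⁺ {r} {c} 1≤r 1≤c c≤L = ∈-concatMap⁺ (λ i → map (i ,_) (from1 (L i))) {xs = from1 n}
    (lose (∈-from1⁺ n 1≤r r≤n) (∈-map⁺ (r ,_) (∈-from1⁺ (L r) 1≤c c≤L)))
    where
    r≤n : r ≤ n
    r≤n = ≮⇒≥ λ n<r → <⇒≱ 1≤c (subst (c ≤_) (codeW-out n<r) c≤L)

  bottomGrid : Grid
  bottomGrid r c = does (c ≤? L r)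

  rowWord-bottomGrid : ∀ {B} r → L r ≤ B → rowWord bottomGrid B r ≡ rowLetters r (L r)
  rowWord-bottomGrid {B} r L≤B with countdown-split L≤B
  ... | hi , eq , L<hi = begin
    concatMap (letter bottomGrid r) (countdown B)               ≡⟨ cong (concatMap (letter bottomGrid r)) eq ⟩
    concatMap (letter bottomGrid r) (hi ++ countdown (L r))     ≡⟨ concatMap-++ (letter bottomGrid r) hi (countdown (L r)) ⟩
    concatMap (letter bottomGrid r) hi ++ concatMap (letter bottomGrid r) (countdown (L r))
      ≡⟨ cong₂ _++_ (concatMap-≡[] hi λ c∈ → letter-false bottomGrid r _ (dec-false (_ ≤? L r) (<⇒≱ (All.lookup L<hi c∈))))
                    (letters-full bottomGrid r (countdown (L r)) λ c∈ → dec-true (_ ≤? L r) (proj₂ (∈-countdown⁻ (L r) c∈))) ⟩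
    rowLetters r (L r)                                          ∎
    where open ≡-Reasoning

  word-Pbott : word (Pbott w) ≡ bottomWord 1 n
  word-Pbott = begin
    word (Pbott w)                       ≡⟨ word≡gridWord (Pbott w) (m≤n+m (bound (Pbott w)) n) ⟩
    gridWord (occupied (Pbott w)) B      ≡⟨ gridWord-cong B (λ r c 1≤r _ 1≤c _ → occupied≡bottomGrid 1≤r 1≤c) ⟩
    gridWord bottomGrid B                ≡⟨ concatMap-cong (λ r → rowWord-bottomGrid r (L≤B r)) (interval 1 B) ⟩
    bottomWord 1 B                       ≡⟨ bottomWord-pad (bound (Pbott w)) ⟩
    bottomWord 1 n                       ∎
    where
    open ≡-Reasoning
    B = n + bound (Pbott w)
    L≤B : ∀ r → L r ≤ B
    L≤B r = ≤-trans (codeW≤ r) (≤-trans (m∸n≤m n r) (m≤m+n n _))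
    occupied≡bottomGrid : ∀ {r c} → 1 ≤ r → 1 ≤ c → occupied (Pbott w) r c ≡ bottomGrid r c
    occupied≡bottomGrid {r} {c} 1≤r 1≤c = by-cases (c ≤? L r)
      where
      by-cases : Dec (c ≤ L r) → occupied (Pbott w) r c ≡ bottomGrid r c
      by-cases (yes c≤L) = trans (dec-true ((r , c) ∈? Pbott w) (∈-Pbott⁺ 1≤r 1≤c c≤L)) (sym (dec-true (c ≤? L r) c≤L))
      by-cases (no c≰L)  = trans (dec-false ((r , c) ∈? Pbott w) (c≰L ∘ proj₂ ∘ proj₂ ∘ ∈-Pbott⁻)) (sym (dec-false (c ≤? L r) c≰L))

  Pbott-reduced : IsReducedPD w (Pbott w)
  Pbott-reduced =
      All.tabulate (λ rc∈ → let (1≤r , 1≤c , _) = ∈-Pbott⁻ rc∈ in 1≤r , 1≤c)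
    , (λ x → trans (cong (λ u → prodWord u x) word-Pbott) (prodWord-bottomWord x))
    , trans (cong length word-Pbott) (trans (length-bottomWord 1 n) (cong (sum ∘ map L) (sym (from1≡interval n))))

numT : (T : Tree) → Pos T → ℕ
numT T p = leftSpine (subtree T p)

depthT : ∀ {T} → Pos T → ℕ
depthT here    = 0
depthT (goL p) = suc (depthT p)
depthT (goR p) = suc (depthT p)

ValidT : (T : Tree) → (Pos T → ℕ) → Set
ValidT T h = (∀ p q → LeftChild {T} p q → h p ≤ h q) × (∀ p q → RightChild {T} p q → h p < h q)

module _ {l r : Tree} {h : Pos (node l r) → ℕ} (valid : ValidT (node l r) h) where

  ValidT-goL : ValidT l (h ∘ goL)
  ValidT-goL = (λ p q → proj₁ valid _ _ ∘ lc-left) , (λ p q → proj₂ valid _ _ ∘ rc-left)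

  ValidT-goR : ValidT r (h ∘ goR)
  ValidT-goR = (λ p q → proj₁ valid _ _ ∘ lc-right) , (λ p q → proj₂ valid _ _ ∘ rc-right)

leaves≥1 : ∀ T → 1 ≤ leaves T
leaves≥1 leaf       = ≤-refl
leaves≥1 (node l r) = ≤-trans (leaves≥1 l) (m≤m+n _ _)

o<o+leaves : ∀ o T → o < o + leaves T
o<o+leaves o T = subst (_≤ o + leaves T) (+-comm o 1) (+-monoʳ-≤ o (leaves≥1 T))

leftSpine<leaves : ∀ T → leftSpine T < leaves T
leftSpine<leaves leaf       = ≤-refl
leftSpine<leaves (node l r) = ≤-trans (s≤s (leftSpine<leaves l))
  (≤-trans (≤-reflexive (+-comm 1 (leaves l))) (+-monoʳ-≤ (leaves l) (leaves≥1 r)))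

numT≥1 : ∀ T p → 1 ≤ numT T p
numT≥1 (node l r) here    = s≤s z≤n
numT≥1 (node l r) (goL p) = numT≥1 l p
numT≥1 (node l r) (goR p) = numT≥1 r p

ρT≥o : ∀ T p o → o ≤ ρT T p o
ρT≥o (node l r) here    o = ≤-refl
ρT≥o (node l r) (goL p) o = ρT≥o l p o
ρT≥o (node l r) (goR p) o = ≤-trans (m≤m+n o (leaves l)) (ρT≥o r p (o + leaves l))

ρT+numT< : ∀ T p o → ρT T p o + numT T p < o + leaves T
ρT+numT< (node l r) here    o = +-monoʳ-< o (leftSpine<leaves (node l r))
ρT+numT< (node l r) (goL p) o = ≤-trans (ρT+numT< l p o) (+-monoʳ-≤ o (m≤m+n _ _))
ρT+numT< (node l r) (goR p) o = ≤-trans (ρT+numT< r p (o + leaves l)) (≤-reflexive (+-assoc o (leaves l) (leaves r)))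

LeftChild-ρT : ∀ {T} {p q : Pos T} o → LeftChild p q → ρT T p o ≡ ρT T q o
LeftChild-ρT o lc-here = refl
LeftChild-ρT o (lc-left c) = LeftChild-ρT o c
LeftChild-ρT {node l r} o (lc-right c) = LeftChild-ρT (o + leaves l) c

RightChild-ρT : ∀ {T} {p q : Pos T} o → RightChild p q → ρT T p o < ρT T q o
RightChild-ρT {node l _} o rc-here = o<o+leaves o l
RightChild-ρT o (rc-left c) = RightChild-ρT o c
RightChild-ρT {node l r} o (rc-right c) = RightChild-ρT (o + leaves l) c

LeftChild-depthT : ∀ {T} {p q : Pos T} → LeftChild p q → depthT p < depthT q
LeftChild-depthT lc-here      = s≤s z≤n
LeftChild-depthT (lc-left c)  = s≤s (LeftChild-depthT c)
LeftChild-depthT (lc-right c) = s≤s (LeftChild-depthT c)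

RightChild-depthT : ∀ {T} {p q : Pos T} → RightChild p q → depthT p < depthT q
RightChild-depthT rc-here      = s≤s z≤n
RightChild-depthT (rc-left c)  = s≤s (RightChild-depthT c)
RightChild-depthT (rc-right c) = s≤s (RightChild-depthT c)

_≟Pos_ : ∀ {T} (p q : Pos T) → Dec (p ≡ q)
here  ≟Pos here  = yes refl
here  ≟Pos goL q = no λ ()
here  ≟Pos goR q = no λ ()
goL p ≟Pos here  = no λ ()
goL p ≟Pos goL q with p ≟Pos q
... | yes refl = yes refl
... | no p≢q   = no λ { refl → p≢q refl }
goL p ≟Pos goR q = no λ ()
goR p ≟Pos here  = no λ ()
goR p ≟Pos goL q = no λ ()
goR p ≟Pos goR q with p ≟Pos q
... | yes refl = yes refl
... | no p≢q   = no λ { refl → p≢q refl }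

-- p is a proper ancestor of q, either on the left spine above q (same ρ) or across a right edge.
data AboveT (T : Tree) (o : ℕ) (p q : Pos T) : Set where
  spine : ρT T p o ≡ ρT T q o → numT T q < numT T p → (∀ h → ValidT T h → h p ≤ h q) → depthT p < depthT q → AboveT T o p q
  right : ρT T p o < ρT T q o → (∀ h → ValidT T h → h p < h q) → depthT p < depthT q → AboveT T o p q

data RelativeT (T : Tree) (o : ℕ) (p q : Pos T) : Set where
  same     : p ≡ q → RelativeT T o p q
  above    : AboveT T o p q → RelativeT T o p q
  below    : AboveT T o q p → RelativeT T o p q
  left-of  : ρT T p o + numT T p < ρT T q o → RelativeT T o p q
  right-of : ρT T q o + numT T q < ρT T p o → RelativeT T o p q

module _ {l r : Tree} {o : ℕ} where

  AboveT-goL : ∀ {p q} → AboveT l o p q → AboveT (node l r) o (goL p) (goL q)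
  AboveT-goL (spine ρ≡ num< h≤ d<) = spine ρ≡ num< (λ h → h≤ (h ∘ goL) ∘ ValidT-goL) (s≤s d<)
  AboveT-goL (right ρ< h< d<)      = right ρ< (λ h → h< (h ∘ goL) ∘ ValidT-goL) (s≤s d<)

  AboveT-goR : ∀ {p q} → AboveT r (o + leaves l) p q → AboveT (node l r) o (goR p) (goR q)
  AboveT-goR (spine ρ≡ num< h≤ d<) = spine ρ≡ num< (λ h → h≤ (h ∘ goR) ∘ ValidT-goR) (s≤s d<)
  AboveT-goR (right ρ< h< d<)      = right ρ< (λ h → h< (h ∘ goR) ∘ ValidT-goR) (s≤s d<)

  RelativeT-goL : ∀ {p q} → RelativeT l o p q → RelativeT (node l r) o (goL p) (goL q)
  RelativeT-goL (same refl)   = same refl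
  RelativeT-goL (above p↑q)   = above (AboveT-goL p↑q)
  RelativeT-goL (below q↑p)   = below (AboveT-goL q↑p)
  RelativeT-goL (left-of lt)  = left-of lt
  RelativeT-goL (right-of lt) = right-of lt

  RelativeT-goR : ∀ {p q} → RelativeT r (o + leaves l) p q → RelativeT (node l r) o (goR p) (goR q)
  RelativeT-goR (same refl)   = same refl
  RelativeT-goR (above p↑q)   = above (AboveT-goR p↑q)
  RelativeT-goR (below q↑p)   = below (AboveT-goR q↑p)
  RelativeT-goR (left-of lt)  = left-of lt
  RelativeT-goR (right-of lt) = right-of lt

root-above : ∀ l r o (q : Pos (node l r)) → q ≡ here ⊎ AboveT (node l r) o here q
root-above l r o here = inj₁ refl
root-above (node a b) r o (goL q) with root-above a b o q
... | inj₁ refl = inj₂ (spine refl ≤-refl (λ h valid → proj₁ valid _ _ lc-here) (s≤s z≤n))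
... | inj₂ (spine ρ≡ num< h≤ _) = inj₂ (spine ρ≡ (m<n⇒m<1+n num<)
        (λ h valid → ≤-trans (proj₁ valid _ _ lc-here) (h≤ (h ∘ goL) (ValidT-goL valid))) (s≤s z≤n))
... | inj₂ (right ρ< h< _) = inj₂ (right ρ<
        (λ h valid → ≤-<-trans (proj₁ valid _ _ lc-here) (h< (h ∘ goL) (ValidT-goL valid))) (s≤s z≤n))
root-above l (node a b) o (goR q) with root-above a b (o + leaves l) q
... | inj₁ refl = inj₂ (right (o<o+leaves o l) (λ h valid → proj₂ valid _ _ rc-here) (s≤s z≤n))
... | inj₂ (spine ρ≡ _ h≤ _) = inj₂ (right (subst (o <_) ρ≡ (o<o+leaves o l))
        (λ h valid → <-≤-trans (proj₂ valid _ _ rc-here) (h≤ (h ∘ goR) (ValidT-goR valid))) (s≤s z≤n))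
... | inj₂ (right ρ< h< _) = inj₂ (right (<-trans (o<o+leaves o l) ρ<)
        (λ h valid → <-trans (proj₂ valid _ _ rc-here) (h< (h ∘ goR) (ValidT-goR valid))) (s≤s z≤n))

relativeT : ∀ T o (p q : Pos T) → RelativeT T o p q
relativeT (node l r) o here q = [ same ∘ sym , above ]′ (root-above l r o q)
relativeT (node l r) o (goL p) here = [ (λ ()) , below ]′ (root-above l r o (goL p))
relativeT (node l r) o (goR p) here = [ (λ ()) , below ]′ (root-above l r o (goR p))
relativeT (node l r) o (goL p) (goL q) = RelativeT-goL (relativeT l o p q)
relativeT (node l r) o (goR p) (goR q) = RelativeT-goR (relativeT r (o + leaves l) p q)
relativeT (node l r) o (goL p) (goR q) = left-of (≤-trans (ρT+numT< l p o) (ρT≥o r q (o + leaves l)))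
relativeT (node l r) o (goR p) (goL q) = right-of (≤-trans (ρT+numT< l q o) (ρT≥o r p (o + leaves l)))

depth : (F : Forest) → IN F → ℕ
depth F (k , p) = depthT p

data Above (F : Forest) (u v : IN F) : Set where
  spine : ρ F u ≡ ρ F v → num F v < num F u → (∀ f → Valid F f → f u ≤ f v) → depth F u < depth F v → Above F u v
  right : ρ F u < ρ F v → (∀ f → Valid F f → f u < f v) → depth F u < depth F v → Above F u v

data Relative (F : Forest) (u v : IN F) : Set where
  same     : u ≡ v → Relative F u v
  above    : Above F u v → Relative F u v
  below    : Above F v u → Relative F u v
  left-of  : ρ F u + num F u < ρ F v → Relative F u v
  right-of : ρ F v + num F v < ρ F u → Relative F u v

Valid⇒ValidT : ∀ {F f} → Valid F f → ∀ k → ValidT (treeOf F k) (λ p → f (k , p))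
Valid⇒ValidT (_ , _ , left-≤ , right-<) k = left-≤ k , right-< k

module _ (F : Forest) (k : Fin (length F)) where

  AboveT⇒Above : ∀ {p q} → AboveT (treeOf F k) (startOf F k) p q → Above F (k , p) (k , q)
  AboveT⇒Above (spine ρ≡ num< f≤ d<) = spine ρ≡ num< (λ f valid → f≤ _ (Valid⇒ValidT {F} valid k)) d<
  AboveT⇒Above (right ρ< f< d<)      = right ρ< (λ f valid → f< _ (Valid⇒ValidT {F} valid k)) d<

  RelativeT⇒Relative : ∀ {p q} → RelativeT (treeOf F k) (startOf F k) p q → Relative F (k , p) (k , q)
  RelativeT⇒Relative (same refl)   = same refl
  RelativeT⇒Relative (above p↑q)   = above (AboveT⇒Above p↑q)
  RelativeT⇒Relative (below q↑p)   = below (AboveT⇒Above q↑p)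
  RelativeT⇒Relative (left-of lt)  = left-of lt
  RelativeT⇒Relative (right-of lt) = right-of lt

WFfrom-start : ∀ {m} F → WFfrom m F → ∀ k → m ≤ startOf F k
WFfrom-start ((a , T) ∷ F) (m≤a , _)  fzero    = m≤a
WFfrom-start ((a , T) ∷ F) (m≤a , wf) (fsuc k) =
  ≤-trans (≤-trans m≤a (≤-trans (m≤m+n a (leaves T)) (m≤m+n _ 1))) (WFfrom-start F wf k)

WFfrom-separated : ∀ {m} F → WFfrom m F → ∀ {k k′} → toℕ k < toℕ k′ → startOf F k + leaves (treeOf F k) < startOf F k′
WFfrom-separated ((a , T) ∷ F) (_ , wf) {fzero}  {fsuc k′} _ = subst (_≤ startOf F k′) (+-comm (a + leaves T) 1) (WFfrom-start F wf k′)
WFfrom-separated ((a , T) ∷ F) (_ , wf) {fsuc k} {fsuc k′} k<k′ = WFfrom-separated F wf (s≤s⁻¹ k<k′)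

ρ≥start : ∀ {m} F → WFfrom m F → ∀ u → m ≤ ρ F u
ρ≥start F wf (k , p) = ≤-trans (WFfrom-start F wf k) (ρT≥o (treeOf F k) p (startOf F k))

earlier-tree-left : ∀ F → WF F → ∀ {k k′} (p : Pos (treeOf F k)) (q : Pos (treeOf F k′)) →
                    toℕ k < toℕ k′ → ρ F (k , p) + num F (k , p) < ρ F (k′ , q)
earlier-tree-left F wf {k} {k′} p q k<k′ = ≤-trans (ρT+numT< (treeOf F k) p (startOf F k))
  (≤-trans (<⇒≤ (WFfrom-separated F wf k<k′)) (ρT≥o (treeOf F k′) q (startOf F k′)))

relative : ∀ F → WF F → ∀ u v → Relative F u v
relative F wf (k , p) (k′ , q) with <-cmp (toℕ k) (toℕ k′)
... | tri< k<k′ _ _ = left-of (earlier-tree-left F wf p q k<k′)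
... | tri> _ _ k′<k = right-of (earlier-tree-left F wf q p k′<k)
... | tri≈ _ k≡k′ _ with Fin.toℕ-injective k≡k′
...   | refl = RelativeT⇒Relative F k (relativeT (treeOf F k) (startOf F k) p q)

length-filter-map : ∀ {P : C → Set} (P? : Decidable P) (g : A → C) xs →
                    length (filter P? (map g xs)) ≡ length (filter (P? ∘ g) xs)
length-filter-map P? g []       = refl
length-filter-map P? g (x ∷ xs) with does (P? (g x))
... | true  = cong suc (length-filter-map P? g xs)
... | false = length-filter-map P? g xs

length-filter-++ : ∀ {P : A → Set} (P? : Decidable P) xs ys →
                   length (filter P? (xs ++ ys)) ≡ length (filter P? xs) + length (filter P? ys)
length-filter-++ P? xs ys = trans (cong length (filter-++ P? xs ys)) (length-++ (filter P? xs))

allPos-complete : ∀ T (p : Pos T) → p ∈ allPos T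
allPos-complete (node l r) here    = here refl
allPos-complete (node l r) (goL p) = there (∈-++⁺ˡ (∈-map⁺ goL (allPos-complete l p)))
allPos-complete (node l r) (goR p) = there (∈-++⁺ʳ (map goL (allPos l)) (∈-map⁺ goR (allPos-complete r p)))

allIN-complete : ∀ F (u : IN F) → u ∈ allIN F
allIN-complete F (k , p) = ∈-concatMap⁺ (λ k → map (k ,_) (allPos (treeOf F k))) {xs = allFin (length F)}
  (lose (∈-allFin k) (∈-map⁺ (k ,_) (allPos-complete (treeOf F k) p)))

codeT : Tree → ℕ → ℕ → ℕ
codeT T o i = length (filter (λ p → ρT T p o ≟ i) (allPos T))

module _ (l r : Tree) (o i : ℕ) where
  private
    ρ≟i : (p : Pos (node l r)) → Dec (ρT (node l r) p o ≡ i)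
    ρ≟i p = ρT (node l r) p o ≟ i

    children-list : List (Pos (node l r))
    children-list = map goL (allPos l) ++ map goR (allPos r)

    children : length (filter ρ≟i children-list) ≡ codeT l o i + codeT r (o + leaves l) i
    children = trans (length-filter-++ ρ≟i (map goL (allPos l)) (map goR (allPos r)))
      (cong₂ _+_ (length-filter-map ρ≟i goL (allPos l)) (length-filter-map ρ≟i goR (allPos r)))

  codeT-node-≡ : o ≡ i → codeT (node l r) o i ≡ suc (codeT l o i + codeT r (o + leaves l) i)
  codeT-node-≡ o≡i = trans (cong length (filter-accept ρ≟i {x = here} {xs = children-list} o≡i)) (cong suc children)

  codeT-node-≢ : o ≢ i → codeT (node l r) o i ≡ codeT l o i + codeT r (o + leaves l) i
  codeT-node-≢ o≢i = trans (cong length (filter-reject ρ≟i {x = here} {xs = children-list} o≢i)) children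

codeT-none : ∀ T o i → (∀ p → ρT T p o ≢ i) → codeT T o i ≡ 0
codeT-none T o i none = cong length (filter-none (λ p → ρT T p o ≟ i) {xs = allPos T} (All.tabulate λ {p} _ → none p))

codeT-left : ∀ l r o {i} → i < o + leaves l → codeT r (o + leaves l) i ≡ 0
codeT-left l r o i<o+l = codeT-none r (o + leaves l) _ λ q ρ≡i → <⇒≱ i<o+l (subst (_ ≤_) ρ≡i (ρT≥o r q (o + leaves l)))

codeT-right : ∀ l o {i} → o + leaves l ≤ i → codeT l o i ≡ 0
codeT-right l o o+l≤i = codeT-none l o _ λ p ρ≡i → <⇒≱ (≤-<-trans (m≤m+n _ _) (ρT+numT< l p o)) (subst (_ ≤_) (sym ρ≡i) o+l≤i)

codeT-first : ∀ T o → codeT T o o ≡ leftSpine T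
codeT-first leaf       o = refl
codeT-first (node l r) o = trans (codeT-node-≡ l r o o refl)
  (cong suc (trans (cong₂ _+_ (codeT-first l o) (codeT-left l r o (o<o+leaves o l))) (+-identityʳ _)))

codeT-goL : ∀ l r o i → codeT l o i ≤ codeT (node l r) o i
codeT-goL l r o i with o ≟ i
... | yes o≡i = ≤-trans (m≤n⇒m≤1+n (m≤m+n _ _)) (≤-reflexive (sym (codeT-node-≡ l r o i o≡i)))
... | no o≢i  = ≤-trans (m≤m+n _ _) (≤-reflexive (sym (codeT-node-≢ l r o i o≢i)))

codeT-goR : ∀ l r o i → codeT r (o + leaves l) i ≤ codeT (node l r) o i
codeT-goR l r o i with o ≟ i
... | yes o≡i = ≤-trans (m≤n⇒m≤1+n (m≤n+m _ _)) (≤-reflexive (sym (codeT-node-≡ l r o i o≡i)))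
... | no o≢i  = ≤-trans (m≤n+m _ _) (≤-reflexive (sym (codeT-node-≢ l r o i o≢i)))

numT≤codeT : ∀ T o p → numT T p ≤ codeT T o (ρT T p o)
numT≤codeT (node l r) o here    = ≤-reflexive (sym (codeT-first (node l r) o))
numT≤codeT (node l r) o (goL p) = ≤-trans (numT≤codeT l o p) (codeT-goL l r o _)
numT≤codeT (node l r) o (goR p) = ≤-trans (numT≤codeT r (o + leaves l) p) (codeT-goR l r o _)

codeT-vertex : ∀ T o i j → 1 ≤ j → j ≤ codeT T o i → Σ (Pos T) λ p → ρT T p o ≡ i × numT T p ≡ j
codeT-vertex leaf o i j 1≤j j≤0 = ⊥-elim (<⇒≱ 1≤j j≤0)
codeT-vertex (node l r) o i j 1≤j j≤code with o ≟ i
... | yes refl with j ≟ suc (leftSpine l)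
...   | yes refl = here , refl , refl
...   | no j≢top with codeT-vertex l o o j 1≤j (subst (j ≤_) (sym (codeT-first l o))
                      (s≤s⁻¹ (≤∧≢⇒< (≤-trans j≤code (≤-reflexive (codeT-first (node l r) o))) j≢top)))
...     | p , ρ≡ , num≡ = goL p , ρ≡ , num≡
codeT-vertex (node l r) o i j 1≤j j≤code | no o≢i with i <? o + leaves l
... | yes i<o+l with codeT-vertex l o i j 1≤j (≤-trans j≤code (≤-reflexive (trans (codeT-node-≢ l r o i o≢i)
                       (trans (cong (codeT l o i +_) (codeT-left l r o i<o+l)) (+-identityʳ _)))))
...   | p , ρ≡ , num≡ = goL p , ρ≡ , num≡
codeT-vertex (node l r) o i j 1≤j j≤code | no o≢i | no i≮o+l
  with codeT-vertex r (o + leaves l) i j 1≤j (≤-trans j≤code (≤-reflexive (trans (codeT-node-≢ l r o i o≢i)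
         (cong (_+ codeT r (o + leaves l) i) (codeT-right l o (≮⇒≥ i≮o+l))))))
... | q , ρ≡ , num≡ = goR q , ρ≡ , num≡

module _ (a : ℕ) (T : Tree) (F : Forest) where
  private
    shift : IN F → IN ((a , T) ∷ F)
    shift (k , p) = fsuc k , p

    row : ∀ {G : Forest} → Fin (length G) → List (IN G)
    row {G} k = map (k ,_) (allPos (treeOf G k))

    rows-shift : ∀ m (t : Fin m → Fin (length F)) →
      concatMap (row {(a , T) ∷ F}) (tabulate (fsuc ∘ t)) ≡ map shift (concatMap (row {F}) (tabulate t))
    rows-shift zero    t = refl
    rows-shift (suc m) t = trans (cong₂ _++_ (map-∘ (allPos (treeOf F (t fzero)))) (rows-shift m (t ∘ fsuc)))
      (sym (map-++ shift (row {F} (t fzero)) (concatMap (row {F}) (tabulate (t ∘ fsuc)))))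

  allIN-∷ : allIN ((a , T) ∷ F) ≡ map (fzero ,_) (allPos T) ++ map shift (allIN F)
  allIN-∷ = cong (map (fzero ,_) (allPos T) ++_) (rows-shift (length F) id)

  codeF-∷ : ∀ i → codeF ((a , T) ∷ F) i ≡ codeT T a i + codeF F i
  codeF-∷ i = trans (cong (length ∘ filter P?) allIN-∷)
    (trans (length-filter-++ P? (map (fzero ,_) (allPos T)) (map shift (allIN F)))
           (cong₂ _+_ (length-filter-map P? (fzero ,_) (allPos T)) (length-filter-map P? shift (allIN F))))
    where
    P? = λ v → ρ ((a , T) ∷ F) v ≟ i

codeF-none : ∀ F i → (∀ u → ρ F u ≢ i) → codeF F i ≡ 0
codeF-none F i none = cong length (filter-none (λ v → ρ F v ≟ i) {xs = allIN F} (All.tabulate λ {u} _ → none u))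

num≤codeF : ∀ F u → num F u ≤ codeF F (ρ F u)
num≤codeF ((a , T) ∷ F) (fzero , p) =
  ≤-trans (numT≤codeT T a p) (≤-trans (m≤m+n _ _) (≤-reflexive (sym (codeF-∷ a T F _))))
num≤codeF ((a , T) ∷ F) (fsuc k , p) =
  ≤-trans (num≤codeF F (k , p)) (≤-trans (m≤n+m _ _) (≤-reflexive (sym (codeF-∷ a T F _))))

codeF-vertex : ∀ {m} F → WFfrom m F → ∀ i j → 1 ≤ j → j ≤ codeF F i → Σ (IN F) λ u → ρ F u ≡ i × num F u ≡ j
codeF-vertex [] _ i j 1≤j j≤0 = ⊥-elim (<⇒≱ 1≤j j≤0)
codeF-vertex ((a , T) ∷ F) (_ , wf) i j 1≤j j≤code with i <? a + leaves T
... | yes i<a+T with codeT-vertex T a i j 1≤j (≤-trans j≤code (≤-reflexive (trans (codeF-∷ a T F i)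
                       (trans (cong (codeT T a i +_) (codeF-none F i later-trees)) (+-identityʳ _)))))
  where
  later-trees : ∀ u → ρ F u ≢ i
  later-trees u ρ≡i = <⇒≱ i<a+T (≤-trans (m≤m+n (a + leaves T) 1) (subst (_ ≤_) ρ≡i (ρ≥start F wf u)))
...   | p , ρ≡ , num≡ = (fzero , p) , ρ≡ , num≡
codeF-vertex ((a , T) ∷ F) (_ , wf) i j 1≤j j≤code | no i≮a+T
  with codeF-vertex F wf i j 1≤j (≤-trans j≤code (≤-reflexive (trans (codeF-∷ a T F i)
         (cong (_+ codeF F i) (codeT-right T a (≮⇒≥ i≮a+T))))))
... | (k , p) , ρ≡ , num≡ = (fsuc k , p) , ρ≡ , num≡

≋-refl : ∀ {D} → D ≋ D
≋-refl _ = id , id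

≋-sym : ∀ {D E} → D ≋ E → E ≋ D
≋-sym D≋E x = proj₂ (D≋E x) , proj₁ (D≋E x)

≋-trans : ∀ {D E G} → D ≋ E → E ≋ G → D ≋ G
≋-trans D≋E E≋G x = proj₁ (E≋G x) ∘ proj₁ (D≋E x) , proj₂ (D≋E x) ∘ proj₂ (E≋G x)

LadderMove-≋ˡ : ∀ {D₀ D₁ E} → D₀ ≋ D₁ → LadderMove D₁ E → LadderMove D₀ E
LadderMove-≋ˡ D₀≋D₁ (r , c , 1≤r , lower∈ , ∉₁ , ∉₂ , ∉₃ , moved) =
  r , c , 1≤r , proj₂ (D₀≋D₁ _) lower∈ , ∉₁ ∘ proj₁ (D₀≋D₁ _) , ∉₂ ∘ proj₁ (D₀≋D₁ _) , ∉₃ ∘ proj₁ (D₀≋D₁ _) ,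
  λ x → (λ x∈E → [ (λ (x∈ , ≢lower) → inj₁ (proj₂ (D₀≋D₁ x) x∈ , ≢lower)) , inj₂ ]′ (proj₁ (moved x) x∈E))
      , (λ kept → proj₂ (moved x) ([ (λ (x∈ , ≢lower) → inj₁ (proj₁ (D₀≋D₁ x) x∈ , ≢lower)) , inj₂ ]′ kept))

Star-≋ˡ : ∀ {D₀ D₁ E} → D₀ ≋ D₁ → Star LadderMove D₁ E → ∃ λ D → Star LadderMove D₀ D × D ≋ E
Star-≋ˡ {D₀} D₀≋D₁ ε          = D₀ , ε , D₀≋D₁
Star-≋ˡ {E = E} D₀≋D₁ (m ◅ ms) = E , LadderMove-≋ˡ D₀≋D₁ m ◅ ms , ≋-refl

module _ (F : Forest) where

  σ : IN F → ℕ
  σ u = ρ F u + num F u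

  cell : (IN F → ℕ) → IN F → Cell
  cell f u = f u , σ u ∸ f u

  ∈ψ⁺ : ∀ f u → cell f u ∈ ψ F f
  ∈ψ⁺ f u = ∈-map⁺ (cell f) (allIN-complete F u)

  ∈ψ⁻ : ∀ f {x} → x ∈ ψ F f → ∃ λ u → x ≡ cell f u
  ∈ψ⁻ f x∈ with ∈-map⁻ (cell f) x∈
  ... | u , _ , x≡ = u , x≡

  ρ<σ : ∀ u → ρ F u < σ u
  ρ<σ (k , p) = subst (_≤ σ (k , p)) (+-comm (ρ F (k , p)) 1) (+-monoʳ-≤ (ρ F (k , p)) (numT≥1 (treeOf F k) p))

  cell-diagonal : ∀ {f} → Valid F f → ∀ u → f u + (σ u ∸ f u) ≡ σ u
  cell-diagonal (_ , f≤ρ , _) u = m+[n∸m]≡n (≤-trans (f≤ρ u) (<⇒≤ (ρ<σ u)))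

  cell-≡ : ∀ {f g} → Valid F f → Valid F g → ∀ {u v} → cell f u ≡ cell g v → f u ≡ g v × σ u ≡ σ v
  cell-≡ valid-f valid-g {u} {v} eq = cong proj₁ eq ,
    trans (sym (cell-diagonal valid-f u)) (trans (cong₂ _+_ (cong proj₁ eq) (cong proj₂ eq)) (cell-diagonal valid-g v))

  ρ-valid : WF F → Valid F (ρ F)
  ρ-valid wf = ρ≥start F wf , (λ _ → ≤-refl) ,
    (λ k p q → ≤-reflexive ∘ LeftChild-ρT (startOf F k)) , (λ k p q → RightChild-ρT (startOf F k))

  cell-ρ : ∀ u → cell (ρ F) u ≡ (ρ F u , num F u)
  cell-ρ u = cong (ρ F u ,_) (m+n∸m≡n (ρ F u) (num F u))

  Pbott≋ψρ : WF F → ∀ {n} (w : Permutation′ n) → (∀ i → 1 ≤ i → codeF F i ≡ codeW w i) → Pbott w ≋ ψ F (ρ F)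
  Pbott≋ψρ wf w code≡ (i , j) = to , from
    where
    to : (i , j) ∈ Pbott w → (i , j) ∈ ψ F (ρ F)
    to ij∈ with ∈-Pbott⁻ w ij∈
    ... | 1≤i , 1≤j , j≤L with codeF-vertex F wf i j 1≤j (subst (j ≤_) (sym (code≡ i 1≤i)) j≤L)
    ...   | u , refl , refl = subst (_∈ ψ F (ρ F)) (cell-ρ u) (∈ψ⁺ (ρ F) u)
    from : (i , j) ∈ ψ F (ρ F) → (i , j) ∈ Pbott w
    from ij∈ with ∈ψ⁻ (ρ F) ij∈
    ... | u , ij≡ = subst (_∈ Pbott w) (sym (trans ij≡ (cell-ρ u)))
      (∈-Pbott⁺ w 1≤ρ (numT≥1 (treeOf F (proj₁ u)) (proj₂ u)) (subst (num F u ≤_) (code≡ (ρ F u) 1≤ρ) (num≤codeF F u)))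
      where
      1≤ρ = ρ≥start F wf u

module _ (F : Forest) (wf : WF F) where

  _≟IN_ : (u v : IN F) → Dec (u ≡ v)
  _≟IN_ = Data.Product.Properties.≡-dec Fin._≟_ _≟Pos_

  Comparable : IN F → IN F → Set
  Comparable u v = (∀ f → Valid F f → f u < f v) × depth F u < depth F v

  -- Distinct crossings on one diagonal come from vertices joined by a path through a right edge.
  same-diagonal : ∀ u v → σ F u ≡ σ F v → u ≡ v ⊎ Comparable u v ⊎ Comparable v u
  same-diagonal u v σ≡ with relative F wf u v
  ... | same u≡v                  = inj₁ u≡v
  ... | above (spine ρ≡ num< _ _) = ⊥-elim (<⇒≢ (+-mono-≤-< (≤-reflexive (sym ρ≡)) num<) (sym σ≡))
  ... | above (right _ f< d<)     = inj₂ (inj₁ (f< , d<))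
  ... | below (spine ρ≡ num< _ _) = ⊥-elim (<⇒≢ (+-mono-≤-< (≤-reflexive (sym ρ≡)) num<) σ≡)
  ... | below (right _ f< d<)     = inj₂ (inj₂ (f< , d<))
  ... | left-of σu<ρv             = ⊥-elim (<⇒≢ (<-trans σu<ρv (ρ<σ F v)) σ≡)
  ... | right-of σv<ρu            = ⊥-elim (<⇒≢ (<-trans σv<ρu (ρ<σ F u)) (sym σ≡))

  cell-injective : ∀ {f} → Valid F f → ∀ {u v} → cell F f u ≡ cell F f v → u ≡ v
  cell-injective {f} valid-f {u} {v} eq with cell-≡ F valid-f valid-f eq
  ... | fu≡fv , σ≡ with same-diagonal u v σ≡
  ...   | inj₁ u≡v             = u≡v
  ...   | inj₂ (inj₁ (f< , _)) = ⊥-elim (<⇒≢ (f< f valid-f) fu≡fv)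
  ...   | inj₂ (inj₂ (f< , _)) = ⊥-elim (<⇒≢ (f< f valid-f) (sym fu≡fv))

  ψ-cong : ∀ {f g} → (∀ u → f u ≡ g u) → ψ F f ≡ ψ F g
  ψ-cong f≗g = map-cong (λ u → cong₂ _,_ (f≗g u) (cong (σ F u ∸_) (f≗g u))) (allIN F)

  -- Lowering the label of a topmost vertex v with f v < h v by one is a simple ladder move on ψ.
  module Lowering {f h : IN F → ℕ} (valid-f : Valid F f) (valid-h : Valid F h) (f≤h : ∀ u → f u ≤ h u)
                  (v : IN F) (f<h : f v < h v) (top : ∀ u → depth F u < depth F v → h u ≡ f u) where

    lowered : IN F → ℕ
    lowered u = if does (u ≟IN v) then h u ∸ 1 else h u

    lowered-v : lowered v ≡ h v ∸ 1
    lowered-v = cong (λ b → if b then h v ∸ 1 else h v) (dec-true (v ≟IN v) refl)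

    lowered-other : ∀ {u} → u ≢ v → lowered u ≡ h u
    lowered-other {u} u≢v = cong (λ b → if b then h u ∸ 1 else h u) (dec-false (u ≟IN v) u≢v)

    f≤h∸1 : f v ≤ h v ∸ 1
    f≤h∸1 = ∸-monoˡ-≤ 1 f<h

    lowered≤h : ∀ u → lowered u ≤ h u
    lowered≤h u = by-cases (u ≟IN v)
      where
      by-cases : Dec (u ≡ v) → lowered u ≤ h u
      by-cases (yes refl) = ≤-trans (≤-reflexive lowered-v) (m∸n≤m (h v) 1)
      by-cases (no u≢v)   = ≤-reflexive (lowered-other u≢v)

    f≤lowered : ∀ u → f u ≤ lowered u
    f≤lowered u = by-cases (u ≟IN v)
      where
      by-cases : Dec (u ≡ v) → f u ≤ lowered u
      by-cases (yes refl) = subst (f v ≤_) (sym lowered-v) f≤h∸1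
      by-cases (no u≢v)   = subst (f u ≤_) (sym (lowered-other u≢v)) (f≤h u)

    -- A parent of v keeps its label, which is f's, so the constraint to v survives; all other constraints only relax.
    lowered-mono : ∀ (_R_ : ℕ → ℕ → Set) → (∀ {x y z} → x ≤ y → y R z → x R z) → (∀ {x y z} → x R y → y ≤ z → x R z) →
                   ∀ {p q} → depth F p < depth F q → h p R h q → f p R f q → lowered p R lowered q
    lowered-mono _R_ ≤-R R-≤ {p} {q} d< hp-R-hq fp-R-fq = by-cases (q ≟IN v)
      where
      by-cases : Dec (q ≡ v) → lowered p R lowered q
      by-cases (yes refl) = ≤-R (≤-reflexive (trans (lowered-other p≢q) (top p d<))) (R-≤ fp-R-fq (f≤lowered q))
        where
        p≢q : p ≢ q
        p≢q refl = <-irrefl refl d<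
      by-cases (no q≢v) = ≤-R (lowered≤h p) (R-≤ hp-R-hq (≤-reflexive (sym (lowered-other q≢v))))

    lowered-valid : Valid F lowered
    lowered-valid = let (f≥1 , _ , _ , _) = valid-f ; (_ , h≤ρ , h-left , h-right) = valid-h ; (_ , _ , f-left , f-right) = valid-f in
        (λ u → ≤-trans (f≥1 u) (f≤lowered u))
      , (λ u → ≤-trans (lowered≤h u) (h≤ρ u))
      , (λ k p q c → lowered-mono _≤_ ≤-trans ≤-trans (LeftChild-depthT c) (h-left k p q c) (f-left k p q c))
      , (λ k p q c → lowered-mono _<_ ≤-<-trans <-≤-trans (RightChild-depthT c) (h-right k p q c) (f-right k p q c))

    private
      H c : ℕ
      H = h v ∸ 1
      c = σ F v ∸ h v

      h-v≡ : h v ≡ suc H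
      h-v≡ = sym (m+[n∸m]≡n (≤-trans (s≤s z≤n) f<h))

      σ-v≡ : σ F v ≡ suc H + c
      σ-v≡ = trans (sym (cell-diagonal F valid-h v)) (cong (_+ c) h-v≡)

      old : cell F h v ≡ (suc H , c)
      old = cong (_, c) h-v≡

      new : cell F lowered v ≡ (H , suc c)
      new = cong₂ _,_ lowered-v (begin
        σ F v ∸ lowered v    ≡⟨ cong (σ F v ∸_) lowered-v ⟩
        σ F v ∸ H            ≡⟨ cong (_∸ H) σ-v≡ ⟩
        suc H + c ∸ H        ≡⟨ cong (_∸ H) (+-suc H c) ⟨
        H + suc c ∸ H        ≡⟨ m+n∸m≡n H (suc c) ⟩
        suc c                ∎)
        where open ≡-Reasoning

      unchanged : ∀ {u} → u ≢ v → cell F lowered u ≡ cell F h u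
      unchanged u≢v = cong₂ _,_ (lowered-other u≢v) (cong (σ F _ ∸_) (lowered-other u≢v))

      at : ∀ {u a b} → cell F h u ≡ (a , b) → h u ≡ a × σ F u ≡ a + b
      at {u} eq = cong proj₁ eq , trans (sym (cell-diagonal F valid-h u)) (cong₂ _+_ (cong proj₁ eq) (cong proj₂ eq))

      -- No other crossing of ψ h lies in row H on diagonal σ v − 2 or σ v − 1.
      north-free : ∀ u → suc (h u) ≡ h v → suc (σ F u) ≡ σ F v ⊎ σ F u ≡ σ F v → ⊥
      north-free u hu<hv σ≈ = by-position (relative F wf u v)
        where
        σu≤σv : σ F u ≤ σ F v
        σu≤σv = [ (λ σ≡ → ≤-trans (n≤1+n _) (≤-reflexive σ≡)) , ≤-reflexive ]′ σ≈
        σv≤1+σu : σ F v ≤ suc (σ F u)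
        σv≤1+σu = [ ≤-reflexive ∘ sym , (λ σ≡ → ≤-trans (≤-reflexive (sym σ≡)) (n≤1+n _)) ]′ σ≈
        by-position : Relative F u v → ⊥
        by-position (same refl)                 = 1+n≢n hu<hv
        by-position (above (spine ρ≡ num< _ _)) = <⇒≱ (+-mono-≤-< (≤-reflexive (sym ρ≡)) num<) σu≤σv
        by-position (above (right _ f< d<))     =
          <⇒≱ (f< f valid-f) (≤-trans f≤h∸1 (≤-reflexive (trans (cong (_∸ 1) (sym hu<hv)) (top u d<))))
        by-position (below (spine _ _ h≤ _))    = <⇒≱ (≤-reflexive hu<hv) (h≤ h valid-h)
        by-position (below (right _ h< _))      = <⇒≱ (≤-reflexive hu<hv) (<⇒≤ (h< h valid-h))
        by-position (left-of σu<ρv)             = <⇒≱ (≤-<-trans σu<ρv (ρ<σ F v)) σv≤1+σu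
        by-position (right-of σv<ρu)            = <⇒≱ (<-trans σv<ρu (ρ<σ F u)) σu≤σv

      -- … nor in row H + 1 on diagonal σ v.
      east-free : ∀ u → h u ≡ h v → σ F u ≡ suc (σ F v) → ⊥
      east-free u hu≡hv σu≡ = by-position (relative F wf u v)
        where
        by-position : Relative F u v → ⊥
        by-position (same refl)                 = 1+n≢n (sym σu≡)
        by-position (above (spine _ _ f≤ d<))   = <⇒≢ (≤-<-trans (≤-reflexive (top u d<)) (≤-<-trans (f≤ f valid-f) f<h)) hu≡hv
        by-position (above (right _ f< d<))     = <⇒≢ (≤-<-trans (≤-reflexive (top u d<)) (<-trans (f< f valid-f) f<h)) hu≡hv
        by-position (below (spine ρ≡ num< _ _)) = <⇒≱ (+-mono-≤-< (≤-reflexive (sym ρ≡)) num<) (≤-trans (n≤1+n _) (≤-reflexive (sym σu≡)))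
        by-position (below (right _ h< _))      = <⇒≢ (h< h valid-h) (sym hu≡hv)
        by-position (left-of σu<ρv)             = <⇒≱ (<-trans σu<ρv (ρ<σ F v)) (≤-trans (n≤1+n _) (≤-reflexive (sym σu≡)))
        by-position (right-of σv<ρu)            = <⇒≢ (<-≤-trans (s≤s σv<ρu) (ρ<σ F u)) (sym σu≡)

    potential-decreases : sum (map (λ u → lowered u ∸ f u) (allIN F)) < sum (map (λ u → h u ∸ f u) (allIN F))
    potential-decreases = sum-map-mono-< (λ u → ∸-monoˡ-≤ (f u) (lowered≤h u)) (allIN-complete F v) (begin-strict
      lowered v ∸ f v  ≡⟨ cong (_∸ f v) lowered-v ⟩
      H ∸ f v          <⟨ n<1+n (H ∸ f v) ⟩
      suc (H ∸ f v)    ≡⟨ +-∸-assoc 1 f≤h∸1 ⟨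
      suc H ∸ f v      ≡⟨ cong (_∸ f v) h-v≡ ⟨
      h v ∸ f v        ∎)
      where open ≤-Reasoning

    ladder : LadderMove (ψ F h) (ψ F lowered)
    ladder = H , c , ≤-trans (proj₁ valid-f v) f≤h∸1 , subst (_∈ ψ F h) old (∈ψ⁺ F h v) , north∉ , northeast∉ , east∉ , moved
      where
      north∉ : (H , c) ∉ ψ F h
      north∉ x∈ with ∈ψ⁻ F h x∈
      ... | u , x≡ with at (sym x≡)
      ...   | hu≡ , σu≡ = north-free u (trans (cong suc hu≡) (sym h-v≡)) (inj₁ (trans (cong suc σu≡) (sym σ-v≡)))

      northeast∉ : (H , suc c) ∉ ψ F h
      northeast∉ x∈ with ∈ψ⁻ F h x∈
      ... | u , x≡ with at (sym x≡)
      ...   | hu≡ , σu≡ = north-free u (trans (cong suc hu≡) (sym h-v≡)) (inj₂ (trans σu≡ (trans (+-suc H c) (sym σ-v≡))))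

      east∉ : (suc H , suc c) ∉ ψ F h
      east∉ x∈ with ∈ψ⁻ F h x∈
      ... | u , x≡ with at (sym x≡)
      ...   | hu≡ , σu≡ = east-free u (trans hu≡ (sym h-v≡)) (trans σu≡ (trans (cong suc (+-suc H c)) (cong suc (sym σ-v≡))))

      moved : ∀ x → (x ∈ ψ F lowered → (x ∈ ψ F h × x ≢ (suc H , c)) ⊎ x ≡ (H , suc c))
                  × ((x ∈ ψ F h × x ≢ (suc H , c)) ⊎ x ≡ (H , suc c) → x ∈ ψ F lowered)
      moved x = to , from
        where
        to : x ∈ ψ F lowered → (x ∈ ψ F h × x ≢ (suc H , c)) ⊎ x ≡ (H , suc c)
        to x∈ = let (u , x≡) = ∈ψ⁻ F lowered x∈ in by-cases u x≡ (u ≟IN v)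
          where
          by-cases : ∀ u → x ≡ cell F lowered u → Dec (u ≡ v) → (x ∈ ψ F h × x ≢ (suc H , c)) ⊎ x ≡ (H , suc c)
          by-cases u x≡ (yes refl) = inj₂ (trans x≡ new)
          by-cases u x≡ (no u≢v)   = inj₁ (subst (_∈ ψ F h) (sym x≡′) (∈ψ⁺ F h u) ,
                                        λ x≡old → u≢v (cell-injective valid-h (trans (sym x≡′) (trans x≡old (sym old)))))
            where
            x≡′ = trans x≡ (unchanged u≢v)
        from : (x ∈ ψ F h × x ≢ (suc H , c)) ⊎ x ≡ (H , suc c) → x ∈ ψ F lowered
        from (inj₂ x≡new) = subst (_∈ ψ F lowered) (trans new (sym x≡new)) (∈ψ⁺ F lowered v)
        from (inj₁ (x∈ , x≢old)) = let (u , x≡) = ∈ψ⁻ F h x∈ in by-cases u x≡ (u ≟IN v)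
          where
          by-cases : ∀ u → x ≡ cell F h u → Dec (u ≡ v) → x ∈ ψ F lowered
          by-cases u x≡ (yes refl) = ⊥-elim (x≢old (trans x≡ old))
          by-cases u x≡ (no u≢v)   = subst (_∈ ψ F lowered) (trans (unchanged u≢v) (sym x≡)) (∈ψ⁺ F lowered u)

  reach : ∀ {f} → Valid F f → ∀ h → Valid F h → (∀ u → f u ≤ h u) → ∃ λ D → Star LadderMove (ψ F h) D × D ≋ ψ F f
  reach {f} valid-f h valid-h f≤h = go h valid-h f≤h (<-wellFounded (potential h))
    where
    potential : (IN F → ℕ) → ℕ
    potential h = sum (map (λ u → h u ∸ f u) (allIN F))

    go : ∀ h → Valid F h → (∀ u → f u ≤ h u) → Acc _<_ (potential h) → ∃ λ D → Star LadderMove (ψ F h) D × D ≋ ψ F f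
    go h valid-h f≤h (acc rec) with any? (λ u → ¬? (h u ≟ f u)) (allIN F)
    ... | no ∄disagreement = ψ F h , ε , subst (ψ F h ≋_) (ψ-cong agree) ≋-refl
      where
      agree : ∀ u → h u ≡ f u
      agree u = decidable-stable (h u ≟ f u) λ hu≢fu → ∄disagreement (lose (allIN-complete F u) hu≢fu)
    ... | yes ∃disagreement with minimal (depth F) (allIN-complete F) (λ u → ¬? (h u ≟ f u)) (proj₂ (proj₂ (find ∃disagreement)))
    ...   | v , hv≢fv , above-agree =
      let open Lowering valid-f valid-h f≤h v (≤∧≢⇒< (f≤h v) (hv≢fv ∘ sym)) (λ u d< → decidable-stable (h u ≟ f u) (above-agree u d<))
          (D , steps , D≋ψf) = go lowered lowered-valid f≤lowered (rec potential-decreases)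
      in D , ladder ◅ steps , D≋ψf

  -- The crossing of v in ψ f is that of some u in ψ g on the same diagonal; comparability of u and v excludes f v < g v.
  topmost-≥ : ∀ {f g} → Valid F f → Valid F g → ψ F f ≋ ψ F g → ∀ v → (∀ u → depth F u < depth F v → f u ≡ g u) → g v ≤ f v
  topmost-≥ {f} {g} valid-f valid-g ψf≋ψg v above-agree = ≮⇒≥ λ fv<gv →
    let (u , cell≡) = ∈ψ⁻ F g (proj₁ (ψf≋ψg _) (∈ψ⁺ F f v))
        (fv≡gu , σ≡) = cell-≡ F valid-f valid-g cell≡
    in case-same-diagonal fv<gv fv≡gu (same-diagonal v u σ≡)
    where
    case-same-diagonal : ∀ {u} → f v < g v → f v ≡ g u → v ≡ u ⊎ Comparable v u ⊎ Comparable u v → ⊥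
    case-same-diagonal fv<gv fv≡gu (inj₁ refl)            = <⇒≢ fv<gv fv≡gu
    case-same-diagonal fv<gv fv≡gu (inj₂ (inj₁ (g< , _))) = <⇒≢ (<-trans fv<gv (g< g valid-g)) fv≡gu
    case-same-diagonal {u} fv<gv fv≡gu (inj₂ (inj₂ (f< , d<))) =
      <⇒≢ (subst (_< f v) (above-agree u d<) (f< f valid-f)) (sym fv≡gu)

  ψ-injective : ∀ {f g} → Valid F f → Valid F g → ψ F f ≋ ψ F g → ∀ v → f v ≡ g v
  ψ-injective {f} {g} valid-f valid-g ψf≋ψg v with f v ≟ g v
  ... | yes fv≡gv = fv≡gv
  ... | no fv≢gv with minimal (depth F) (allIN-complete F) (λ u → ¬? (f u ≟ g u)) fv≢gv
  ...   | u , fu≢gu , above-disagree =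
    ⊥-elim (fu≢gu (≤-antisym (topmost-≥ valid-g valid-f (≋-sym ψf≋ψg) u (λ w → sym ∘ agree w)) (topmost-≥ valid-f valid-g ψf≋ψg u agree)))
    where
    agree : ∀ w → depth F w < depth F u → f w ≡ g w
    agree w d< = decidable-stable (f w ≟ g w) (above-disagree w d<)

proposition3p5 : ∀ n (w : Permutation′ n) (F : Forest) → WF F
    → (∀ i → 1 ≤ i → codeF F i ≡ codeW w i)
    → (∀ (f : IN F → ℕ) → Valid F f
         → (∃ λ D → Star LadderMove (Pbott w) D × D ≋ ψ F f)
           × IsReducedPD w (ψ F f))
      × (∀ (f g : IN F → ℕ) → Valid F f → Valid F g → ψ F f ≋ ψ F g → ∀ v → f v ≡ g v)
proposition3p5 n w F wf code≡ = reachable-and-reduced , λ f g → ψ-injective F wf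
  where
  reachable-and-reduced : ∀ f → Valid F f → (∃ λ D → Star LadderMove (Pbott w) D × D ≋ ψ F f) × IsReducedPD w (ψ F f)
  reachable-and-reduced f valid-f =
    let (D , ψρ→*D , D≋ψf) = reach F wf valid-f (ρ F) (ρ-valid F wf) (proj₁ (proj₂ valid-f))
        (D′ , Pbott→*D′ , D′≋D) = Star-≋ˡ (Pbott≋ψρ F wf w code≡) ψρ→*D
        D′≋ψf = ≋-trans D′≋D D≋ψf
    in (D′ , Pbott→*D′ , D′≋ψf) , reduced-≋ w D′≋ψf (reduced-star w Pbott→*D′ (Pbott-reduced w))
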